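{- Let $a,b,c,d,e,f,k,l,p,q,r,s\ge0$ be integers with $a+b$, $c+d$, $e+f$, $k+l$, $p+q$, $r+s$ positive, and let $$E=\begin{bmatrix} J_{k,a} & -J_{k,b} & J_{k,c} & -J_{k,d} & 0 & 0 \\ -J_{l,a} & J_{l,b} & -J_{l,c} & J_{l,d} & 0 & 0 \\ J_{p,a} & -J_{p,b} & 0 & 0 & J_{p,e} & -J_{p,f} \\ -J_{q,a} & J_{q,b} & 0 & 0 & -J_{q,e} & J_{q,f} \\ 0 & 0 & J_{r,c} & -J_{r,d} & -J_{r,e} & J_{r,f} \\ 0 & 0 & -J_{s,c} & J_{s,d} & J_{s,e} & -J_{s,f} \end{bmatrix}$$ (blocks with a zero dimension are absent) with $E\mathbf 1=0$ and $\mathbf 1^TE=0^T$. Then $E$ is realizable if and only if one of the following holds: (i) $a+b$, $c+d$, $e+f$, $k+l$, $p+q$ and $r+s$ are all even; (ii) either the three numbers $a+b$, $c+d$, $e+f$ are all odd or the three numbers $k+l$, $p+q$, $r+s$ are all odd; and $\frac{e+f}{k+l}=\frac{c+d}{p+q}=\frac{a+b}{r+s}$.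
   Context: $J_{p,q}$ is the $p\times q$ all-ones matrix. Two $(0,1)$ matrices $A,B$ are Gram mates if $AA^T=BB^T$, $A^TA=B^TB$ and $A\neq B$. A $(0,1,-1)$ matrix $E$ with $E\mathbf 1=0$ and $\mathbf 1^TE=0^T$ is realizable if there is a $(0,1)$ matrix $A$ such that $A+E$ is a $(0,1)$ matrix and $A$, $A+E$ are Gram mates. -}

module Defs where

open import Data.Nat as ℕ using (ℕ; zero; suc)
open import Data.Integer as ℤ using (ℤ; +_; -_)
open import Data.Fin using (Fin; splitAt)
open import Data.Sum using (_⊎_; inj₁; inj₂)
open import Data.Product using (_×_; ∃)
open import Relation.Binary.PropositionalEquality using (_≡_)
open import Relation.Nullary using (¬_)

Matrix : ℕ → ℕ → Set
Matrix m n = Fin m → Fin n → ℤ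

∑ : ∀ {n} → (Fin n → ℤ) → ℤ
∑ {zero}  f = + 0
∑ {suc n} f = f Fin.zero ℤ.+ ∑ (λ i → f (Fin.suc i))

transpose : ∀ {m n} → Matrix m n → Matrix n m
transpose A j i = A i j

_⊗_ : ∀ {m n p} → Matrix m n → Matrix n p → Matrix m p
(A ⊗ B) i j = ∑ (λ t → A i t ℤ.* B t j)

_⊕_ : ∀ {m n} → Matrix m n → Matrix m n → Matrix m n
(A ⊕ B) i j = A i j ℤ.+ B i j

_≐_ : ∀ {m n} → Matrix m n → Matrix m n → Set
A ≐ B = ∀ i j → A i j ≡ B i j

IsBinary : ∀ {m n} → Matrix m n → Set
IsBinary A = ∀ i j → (A i j ≡ + 0) ⊎ (A i j ≡ + 1)

GramMates : ∀ {m n} → Matrix m n → Matrix m n → Set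
GramMates A B =
  IsBinary A × IsBinary B ×
  ((A ⊗ transpose A) ≐ (B ⊗ transpose B)) ×
  ((transpose A ⊗ A) ≐ (transpose B ⊗ B)) ×
  ¬ (A ≐ B)

RowSumsZero : ∀ {m n} → Matrix m n → Set
RowSumsZero E = ∀ i → ∑ (λ j → E i j) ≡ + 0

ColSumsZero : ∀ {m n} → Matrix m n → Set
ColSumsZero E = ∀ j → ∑ (λ i → E i j) ≡ + 0

Realizable : ∀ {m n} → Matrix m n → Set
Realizable E = ∃ λ A → IsBinary A × IsBinary (A ⊕ E) × GramMates A (A ⊕ E)

data Blk : Set where
  b₁ b₂ b₃ b₄ b₅ b₆ : Blk

block : (x₁ x₂ x₃ x₄ x₅ x₆ : ℕ) →
        Fin (x₁ ℕ.+ (x₂ ℕ.+ (x₃ ℕ.+ (x₄ ℕ.+ (x₅ ℕ.+ x₆))))) → Blk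
block x₁ x₂ x₃ x₄ x₅ x₆ i with splitAt x₁ i
... | inj₁ _ = b₁
... | inj₂ i₂ with splitAt x₂ i₂
... | inj₁ _ = b₂
... | inj₂ i₃ with splitAt x₃ i₃
... | inj₁ _ = b₃
... | inj₂ i₄ with splitAt x₄ i₄
... | inj₁ _ = b₄
... | inj₂ i₅ with splitAt x₅ i₅
... | inj₁ _ = b₅
... | inj₂ _ = b₆

-- Block sign pattern: rows (k,l,p,q,r,s), columns (a,b,c,d,e,f).
pos neg zer : ℤ
pos = + 1
neg = - (+ 1)
zer = + 0

sign : Blk → Blk → ℤ
sign b₁ b₁ = pos
sign b₁ b₂ = neg
sign b₁ b₃ = pos
sign b₁ b₄ = neg
sign b₁ b₅ = zer
sign b₁ b₆ = zer
sign b₂ b₁ = neg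
sign b₂ b₂ = pos
sign b₂ b₃ = neg
sign b₂ b₄ = pos
sign b₂ b₅ = zer
sign b₂ b₆ = zer
sign b₃ b₁ = pos
sign b₃ b₂ = neg
sign b₃ b₃ = zer
sign b₃ b₄ = zer
sign b₃ b₅ = pos
sign b₃ b₆ = neg
sign b₄ b₁ = neg
sign b₄ b₂ = pos
sign b₄ b₃ = zer
sign b₄ b₄ = zer
sign b₄ b₅ = neg
sign b₄ b₆ = pos
sign b₅ b₁ = zer
sign b₅ b₂ = zer
sign b₅ b₃ = pos
sign b₅ b₄ = neg
sign b₅ b₅ = neg
sign b₅ b₆ = pos
sign b₆ b₁ = zer
sign b₆ b₂ = zer
sign b₆ b₃ = neg
sign b₆ b₄ = pos
sign b₆ b₅ = pos
sign b₆ b₆ = neg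

Emat : (a b c d e f k l p q r s : ℕ) →
       Matrix (k ℕ.+ (l ℕ.+ (p ℕ.+ (q ℕ.+ (r ℕ.+ s)))))
              (a ℕ.+ (b ℕ.+ (c ℕ.+ (d ℕ.+ (e ℕ.+ f)))))
Emat a b c d e f k l p q r s i j = sign (block k l p q r s i) (block a b c d e f j)

-- A + E is a (0,1) matrix exactly when A is 1 where E = -1, 0 where E = 1, and arbitrary on the
-- three zero blocks of E.  Expanding (A + E)(A + E)ᵀ - AAᵀ = AEᵀ + EAᵀ + EEᵀ blockwise, and using
-- the zero row and column sums of E, the row Gram condition holds iff there is one integer Λ such that, for every row, twice its
-- signed count of free ones is an affine function of Λ depending only on the row block
-- (`target`); likewise for the columns with some Λ′.  Double counting the free ones of each
-- zero block gives (k+l)Λ = (e+f)Λ′, (p+q)Λ = (c+d)Λ′, (r+s)Λ = (a+b)Λ′, while Λ ≡ a+b and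
-- Λ′ ≡ k+l (mod 2).  So either all sizes are even, or Λ, Λ′ ≠ 0 and the three ratios agree.
-- Conversely, given such Λ, Λ′ (Λ = Λ′ = 0, or Λ and Λ′ the sizes of a smallest pair of column
-- and row blocks), each zero block is filled with a circulant (0,1) matrix with constant line
-- sums, complemented on its two off-diagonal sub-blocks.

module Submission where

open import Defs

-- Nested so that the integer operators used throughout do not clash with the natural-number
-- operators of the statement of theorem4p35.
module _ where
  open import Data.Bool using (if_then_else_)
  open import Data.Nat as ℕ using (ℕ; zero; suc; _>_; NonZero; z<s; s<s; s≤s; _≡ᵇ_)
  import Data.Nat.Properties as ℕP
  open import Data.Nat.DivMod using (_%_; m<n⇒m%n≡m; m%n<n; [m+n]%n≡m%n; [m+kn]%n≡m%n)
  open import Data.Nat.Divisibility using (_∣_; divides; _∣?_; ∣m+n∣m⇒∣n; ∣m∣n⇒∣m+n)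
  open import Data.Nat.Tactic.RingSolver using () renaming (solve-∀ to ℕ-solve-∀)
  open import Data.Integer as ℤ using (ℤ; +_; -_; _+_; _*_; _-_; -[1+_])
  import Data.Integer.Properties as ℤP
  open import Data.Integer.Tactic.RingSolver using (solve-∀)
  open import Algebra.Properties.CommutativeSemigroup ℕP.+-commutativeSemigroup using (interchange)
  open import Algebra.Properties.AbelianGroup ℤP.+-0-abelianGroup
    using (identityʳ-unique; inverseʳ-unique) renaming (∙-cancelʳ to +-cancelʳ)
  open import Data.Fin as Fin using (Fin; toℕ; _↑ˡ_; _↑ʳ_; splitAt)
  open import Data.Fin.Properties using (toℕ-↑ˡ; toℕ-↑ʳ; toℕ<n; splitAt-↑ˡ; splitAt-↑ʳ)
  open import Data.Product using (Σ; _×_; _,_; proj₁; proj₂)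
  open import Data.Product.Properties using (≡-dec)
  import Data.Sum
  open import Data.Sum using (_⊎_; inj₁; inj₂)
  open import Relation.Binary.Definitions using (DecidableEquality)
  open import Relation.Binary.PropositionalEquality
  open import Relation.Nullary using (¬_; Dec; yes; no; ¬?; contradiction)
  open import Relation.Nullary.Decidable using (map′; from-yes; _×-dec_; _⊎-dec_; _→-dec_)

  -- Blocks and pairs of blocks

  tabulateᴮ : ∀ {p} {P : Blk → Set p} → P b₁ → P b₂ → P b₃ → P b₄ → P b₅ → P b₆ → ∀ b → P b
  tabulateᴮ p₁ _ _ _ _ _ b₁ = p₁
  tabulateᴮ _ p₂ _ _ _ _ b₂ = p₂
  tabulateᴮ _ _ p₃ _ _ _ b₃ = p₃
  tabulateᴮ _ _ _ p₄ _ _ b₄ = p₄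
  tabulateᴮ _ _ _ _ p₅ _ b₅ = p₅
  tabulateᴮ _ _ _ _ _ p₆ b₆ = p₆

  ∀ᴮ? : ∀ {p} {P : Blk → Set p} → (∀ b → Dec (P b)) → Dec (∀ b → P b)
  ∀ᴮ? P? = map′ (λ (p₁ , p₂ , p₃ , p₄ , p₅ , p₆) → tabulateᴮ p₁ p₂ p₃ p₄ p₅ p₆)
                (λ h → h b₁ , h b₂ , h b₃ , h b₄ , h b₅ , h b₆)
                (P? b₁ ×-dec P? b₂ ×-dec P? b₃ ×-dec P? b₄ ×-dec P? b₅ ×-dec P? b₆)

  data Pair : Set where
    π₁ π₂ π₃ : Pair

  pairOf : Blk → Pair
  pairOf b₁ = π₁
  pairOf b₂ = π₁
  pairOf b₃ = π₂
  pairOf b₄ = π₂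
  pairOf b₅ = π₃
  pairOf b₆ = π₃

  first second : Pair → Blk
  first π₁ = b₁
  first π₂ = b₃
  first π₃ = b₅
  second π₁ = b₂
  second π₂ = b₄
  second π₃ = b₆

  pairOf-first : ∀ t → pairOf (first t) ≡ t
  pairOf-first π₁ = refl
  pairOf-first π₂ = refl
  pairOf-first π₃ = refl

  pairOf-second : ∀ t → pairOf (second t) ≡ t
  pairOf-second π₁ = refl
  pairOf-second π₂ = refl
  pairOf-second π₃ = refl

  -- The entries of E in the rows of pair t vanish exactly on the columns of pair `partner t`,
  -- and symmetrically.
  partner : Pair → Pair
  partner π₁ = π₃
  partner π₂ = π₂
  partner π₃ = π₁

  partner-involutive : ∀ t → partner (partner t) ≡ t
  partner-involutive π₁ = refl
  partner-involutive π₂ = refl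
  partner-involutive π₃ = refl

  side : Blk → ℤ
  side = tabulateᴮ pos neg pos neg pos neg

  _≟ᴾ_ : DecidableEquality Pair
  π₁ ≟ᴾ π₁ = yes refl
  π₁ ≟ᴾ π₂ = no λ ()
  π₁ ≟ᴾ π₃ = no λ ()
  π₂ ≟ᴾ π₁ = no λ ()
  π₂ ≟ᴾ π₂ = yes refl
  π₂ ≟ᴾ π₃ = no λ ()
  π₃ ≟ᴾ π₁ = no λ ()
  π₃ ≟ᴾ π₂ = no λ ()
  π₃ ≟ᴾ π₃ = yes refl

  sign-symmetric : ∀ r c → sign r c ≡ sign c r
  sign-symmetric = from-yes (∀ᴮ? λ r → ∀ᴮ? λ c → sign r c ℤ.≟ sign c r)

  sign-values : ∀ r c → sign r c ≡ pos ⊎ sign r c ≡ zer ⊎ sign r c ≡ neg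
  sign-values = from-yes (∀ᴮ? λ r → ∀ᴮ? λ c →
    (sign r c ℤ.≟ pos) ⊎-dec (sign r c ℤ.≟ zer) ⊎-dec (sign r c ℤ.≟ neg))

  Σᴮ : (Blk → ℤ) → ℤ
  Σᴮ g = g b₁ + (g b₂ + (g b₃ + (g b₄ + (g b₅ + g b₆))))

  Σᴮ-cong : ∀ {f g : Blk → ℤ} → (∀ b → f b ≡ g b) → Σᴮ f ≡ Σᴮ g
  Σᴮ-cong f≗g = cong₂ _+_ (f≗g b₁) (cong₂ _+_ (f≗g b₂) (cong₂ _+_ (f≗g b₃)
                  (cong₂ _+_ (f≗g b₄) (cong₂ _+_ (f≗g b₅) (f≗g b₆)))))

  pairWeight : Pair → Blk → ℤ
  pairWeight t r with pairOf r ≟ᴾ t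
  ... | yes _ = side r
  ... | no  _ = + 0

  Σᴮ-pairWeight : ∀ t (S : Blk → ℤ) → Σᴮ (λ c → pairWeight t c * S c) ≡ S (first t) - S (second t)
  Σᴮ-pairWeight π₁ S = select (S b₁) (S b₂) (S b₃) (S b₄) (S b₅) (S b₆)
    where
    select : ∀ s₁ s₂ s₃ s₄ s₅ s₆ → pos * s₁ + (neg * s₂ + (zer * s₃ + (zer * s₄ + (zer * s₅ + zer * s₆)))) ≡ s₁ - s₂
    select = solve-∀
  Σᴮ-pairWeight π₂ S = select (S b₁) (S b₂) (S b₃) (S b₄) (S b₅) (S b₆)
    where
    select : ∀ s₁ s₂ s₃ s₄ s₅ s₆ → zer * s₁ + (zer * s₂ + (pos * s₃ + (neg * s₄ + (zer * s₅ + zer * s₆)))) ≡ s₃ - s₄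
    select = solve-∀
  Σᴮ-pairWeight π₃ S = select (S b₁) (S b₂) (S b₃) (S b₄) (S b₅) (S b₆)
    where
    select : ∀ s₁ s₂ s₃ s₄ s₅ s₆ → zer * s₁ + (zer * s₂ + (zer * s₃ + (zer * s₄ + (pos * s₅ + neg * s₆)))) ≡ s₅ - s₆
    select = solve-∀

  -- Finite sums

  ∑-cong : ∀ {n} {f g : Fin n → ℤ} → (∀ i → f i ≡ g i) → ∑ f ≡ ∑ g
  ∑-cong {zero}  f≗g = refl
  ∑-cong {suc n} f≗g = cong₂ _+_ (f≗g Fin.zero) (∑-cong (λ i → f≗g (Fin.suc i)))

  ∑-distrib-+ : ∀ {n} (f g : Fin n → ℤ) → ∑ (λ i → f i + g i) ≡ ∑ f + ∑ g
  ∑-distrib-+ {zero}  f g = refl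
  ∑-distrib-+ {suc n} f g = trans (cong (λ s → f Fin.zero + g Fin.zero + s) (∑-distrib-+ {n} _ _))
                                  (+-interchange (f Fin.zero) (g Fin.zero) _ _)
    where
    +-interchange : ∀ w x y z → w + x + (y + z) ≡ w + y + (x + z)
    +-interchange = solve-∀

  *-distribˡ-∑ : ∀ {n} c (f : Fin n → ℤ) → c * ∑ f ≡ ∑ (λ i → c * f i)
  *-distribˡ-∑ {zero}  c f = ℤP.*-zeroʳ c
  *-distribˡ-∑ {suc n} c f = trans (ℤP.*-distribˡ-+ c (f Fin.zero) _)
                                   (cong (λ s → c * f Fin.zero + s) (*-distribˡ-∑ {n} c _))

  ∑-neg : ∀ {n} (f : Fin n → ℤ) → ∑ (λ i → - f i) ≡ - ∑ f
  ∑-neg {zero}  f = refl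
  ∑-neg {suc n} f = trans (cong (λ s → - f Fin.zero + s) (∑-neg {n} _)) (sym (ℤP.neg-distrib-+ (f Fin.zero) _))

  ∑-const : ∀ n v → ∑ {n} (λ _ → v) ≡ + n * v
  ∑-const zero    v = refl
  ∑-const (suc n) v = trans (cong (_+_ v) (∑-const n v)) (sym (ℤP.suc-* (+ n) v))

  ∑-comm : ∀ {m n} (f : Fin m → Fin n → ℤ) → ∑ (λ i → ∑ (f i)) ≡ ∑ (λ j → ∑ (λ i → f i j))
  ∑-comm {zero}  {n} f = sym (trans (∑-const n (+ 0)) (ℤP.*-zeroʳ (+ n)))
  ∑-comm {suc m} {n} f = trans (cong (λ s → ∑ (f Fin.zero) + s) (∑-comm {m} {n} (λ i → f (Fin.suc i))))
                           (sym (∑-distrib-+ {n} (f Fin.zero) _))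

  ∑-++ : ∀ {m n} (f : Fin (m ℕ.+ n) → ℤ) → ∑ f ≡ ∑ (λ i → f (i ↑ˡ n)) + ∑ (λ i → f (m ↑ʳ i))
  ∑-++ {zero}  f = sym (ℤP.+-identityˡ _)
  ∑-++ {suc m} {n} f = trans (cong (λ s → f Fin.zero + s) (∑-++ {m} {n} (λ i → f (Fin.suc i))))
                             (sym (ℤP.+-assoc (f Fin.zero) _ _))

  ∑< : ℕ → (ℕ → ℤ) → ℤ
  ∑< n g = ∑ {n} (λ t → g (toℕ t))

  ∑<-cong : ∀ n {g h : ℕ → ℤ} → (∀ t → t ℕ.< n → g t ≡ h t) → ∑< n g ≡ ∑< n h
  ∑<-cong n g≗h = ∑-cong (λ t → g≗h (toℕ t) (toℕ<n t))

  ∑<-+ : ∀ m n (g : ℕ → ℤ) → ∑< (m ℕ.+ n) g ≡ ∑< m g + ∑< n (λ t → g (m ℕ.+ t))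
  ∑<-+ m n g = trans (∑-++ {m} {n} (λ t → g (toℕ t)))
                     (cong₂ _+_ (∑-cong {m} (λ t → cong g (toℕ-↑ˡ t n))) (∑-cong {n} (λ t → cong g (toℕ-↑ʳ m t))))

  Fin-+-nonempty : ∀ u v → u ℕ.+ v > 0 → Fin u ⊎ Fin v
  Fin-+-nonempty zero    v pos = inj₂ (Fin.fromℕ< pos)
  Fin-+-nonempty (suc u) v _   = inj₁ Fin.zero

  module Blocks (x₁ x₂ x₃ x₄ x₅ x₆ : ℕ) where

    Size : ℕ
    Size = x₁ ℕ.+ (x₂ ℕ.+ (x₃ ℕ.+ (x₄ ℕ.+ (x₅ ℕ.+ x₆))))

    size : Blk → ℕ
    size = tabulateᴮ x₁ x₂ x₃ x₄ x₅ x₆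

    bl : Fin Size → Blk
    bl = block x₁ x₂ x₃ x₄ x₅ x₆

    offsetInPair : Blk → ℕ
    offsetInPair = tabulateᴮ 0 x₁ 0 x₃ 0 x₅

    loc : Fin Size → ℕ
    loc i with splitAt x₁ i
    ... | inj₁ t = toℕ t
    ... | inj₂ i₂ with splitAt x₂ i₂
    ... | inj₁ t = toℕ t
    ... | inj₂ i₃ with splitAt x₃ i₃
    ... | inj₁ t = toℕ t
    ... | inj₂ i₄ with splitAt x₄ i₄
    ... | inj₁ t = toℕ t
    ... | inj₂ i₅ with splitAt x₅ i₅
    ... | inj₁ t = toℕ t
    ... | inj₂ t = toℕ t

    embed : ∀ b → Fin (size b) → Fin Size
    embed b₁ t = t ↑ˡ _
    embed b₂ t = x₁ ↑ʳ (t ↑ˡ _)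
    embed b₃ t = x₁ ↑ʳ (x₂ ↑ʳ (t ↑ˡ _))
    embed b₄ t = x₁ ↑ʳ (x₂ ↑ʳ (x₃ ↑ʳ (t ↑ˡ _)))
    embed b₅ t = x₁ ↑ʳ (x₂ ↑ʳ (x₃ ↑ʳ (x₄ ↑ʳ (t ↑ˡ _))))
    embed b₆ t = x₁ ↑ʳ (x₂ ↑ʳ (x₃ ↑ʳ (x₄ ↑ʳ (x₅ ↑ʳ t))))

    bl-loc-embed : ∀ b t → bl (embed b t) ≡ b × loc (embed b t) ≡ toℕ t
    bl-loc-embed b₁ t
      rewrite splitAt-↑ˡ x₁ t (x₂ ℕ.+ (x₃ ℕ.+ (x₄ ℕ.+ (x₅ ℕ.+ x₆)))) = refl , refl
    bl-loc-embed b₂ t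
      rewrite splitAt-↑ʳ x₁ (x₂ ℕ.+ (x₃ ℕ.+ (x₄ ℕ.+ (x₅ ℕ.+ x₆)))) (t ↑ˡ (x₃ ℕ.+ (x₄ ℕ.+ (x₅ ℕ.+ x₆))))
            | splitAt-↑ˡ x₂ t (x₃ ℕ.+ (x₄ ℕ.+ (x₅ ℕ.+ x₆))) = refl , refl
    bl-loc-embed b₃ t
      rewrite splitAt-↑ʳ x₁ (x₂ ℕ.+ (x₃ ℕ.+ (x₄ ℕ.+ (x₅ ℕ.+ x₆)))) (x₂ ↑ʳ (t ↑ˡ (x₄ ℕ.+ (x₅ ℕ.+ x₆))))
            | splitAt-↑ʳ x₂ (x₃ ℕ.+ (x₄ ℕ.+ (x₅ ℕ.+ x₆))) (t ↑ˡ (x₄ ℕ.+ (x₅ ℕ.+ x₆)))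
            | splitAt-↑ˡ x₃ t (x₄ ℕ.+ (x₅ ℕ.+ x₆)) = refl , refl
    bl-loc-embed b₄ t
      rewrite splitAt-↑ʳ x₁ (x₂ ℕ.+ (x₃ ℕ.+ (x₄ ℕ.+ (x₅ ℕ.+ x₆)))) (x₂ ↑ʳ (x₃ ↑ʳ (t ↑ˡ (x₅ ℕ.+ x₆))))
            | splitAt-↑ʳ x₂ (x₃ ℕ.+ (x₄ ℕ.+ (x₅ ℕ.+ x₆))) (x₃ ↑ʳ (t ↑ˡ (x₅ ℕ.+ x₆)))
            | splitAt-↑ʳ x₃ (x₄ ℕ.+ (x₅ ℕ.+ x₆)) (t ↑ˡ (x₅ ℕ.+ x₆))
            | splitAt-↑ˡ x₄ t (x₅ ℕ.+ x₆) = refl , refl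
    bl-loc-embed b₅ t
      rewrite splitAt-↑ʳ x₁ (x₂ ℕ.+ (x₃ ℕ.+ (x₄ ℕ.+ (x₅ ℕ.+ x₆)))) (x₂ ↑ʳ (x₃ ↑ʳ (x₄ ↑ʳ (t ↑ˡ x₆))))
            | splitAt-↑ʳ x₂ (x₃ ℕ.+ (x₄ ℕ.+ (x₅ ℕ.+ x₆))) (x₃ ↑ʳ (x₄ ↑ʳ (t ↑ˡ x₆)))
            | splitAt-↑ʳ x₃ (x₄ ℕ.+ (x₅ ℕ.+ x₆)) (x₄ ↑ʳ (t ↑ˡ x₆))
            | splitAt-↑ʳ x₄ (x₅ ℕ.+ x₆) (t ↑ˡ x₆)
            | splitAt-↑ˡ x₅ t x₆ = refl , refl
    bl-loc-embed b₆ t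
      rewrite splitAt-↑ʳ x₁ (x₂ ℕ.+ (x₃ ℕ.+ (x₄ ℕ.+ (x₅ ℕ.+ x₆)))) (x₂ ↑ʳ (x₃ ↑ʳ (x₄ ↑ʳ (x₅ ↑ʳ t))))
            | splitAt-↑ʳ x₂ (x₃ ℕ.+ (x₄ ℕ.+ (x₅ ℕ.+ x₆))) (x₃ ↑ʳ (x₄ ↑ʳ (x₅ ↑ʳ t)))
            | splitAt-↑ʳ x₃ (x₄ ℕ.+ (x₅ ℕ.+ x₆)) (x₄ ↑ʳ (x₅ ↑ʳ t))
            | splitAt-↑ʳ x₄ (x₅ ℕ.+ x₆) (x₅ ↑ʳ t)
            | splitAt-↑ʳ x₅ x₆ t = refl , refl

    ∑-byBlock : ∀ (h : Blk → ℕ → ℤ) → ∑ (λ j → h (bl j) (loc j)) ≡ Σᴮ (λ b → ∑< (size b) (h b))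
    ∑-byBlock h =
      trans (∑-++ {x₁} f)
      (cong₂ _+_ (block-sum b₁) (trans (∑-++ {x₂} (λ i → f (x₁ ↑ʳ i)))
      (cong₂ _+_ (block-sum b₂) (trans (∑-++ {x₃} (λ i → f (x₁ ↑ʳ (x₂ ↑ʳ i))))
      (cong₂ _+_ (block-sum b₃) (trans (∑-++ {x₄} (λ i → f (x₁ ↑ʳ (x₂ ↑ʳ (x₃ ↑ʳ i)))))
      (cong₂ _+_ (block-sum b₄) (trans (∑-++ {x₅} (λ i → f (x₁ ↑ʳ (x₂ ↑ʳ (x₃ ↑ʳ (x₄ ↑ʳ i))))))
      (cong₂ _+_ (block-sum b₅) (block-sum b₆))))))))))
      where
      f : Fin Size → ℤ
      f j = h (bl j) (loc j)
      block-sum : ∀ b → ∑ (λ t → f (embed b t)) ≡ ∑< (size b) (h b)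
      block-sum b = ∑-cong (λ t → let (bl≡ , loc≡) = bl-loc-embed b t in cong₂ h bl≡ loc≡)

    ∑-count : ∀ (g : Blk → ℤ) → ∑ (λ j → g (bl j)) ≡ Σᴮ (λ b → + size b * g b)
    ∑-count g = trans (∑-byBlock (λ b _ → g b)) (Σᴮ-cong (λ b → ∑-const (size b) (g b)))

    inPair : ∀ t → size (first t) ℕ.+ size (second t) > 0 → Σ (Fin Size) (λ j → pairOf (bl j) ≡ t)
    inPair t pos with Fin-+-nonempty (size (first t)) (size (second t)) pos
    ... | inj₁ i = embed (first t) i , trans (cong pairOf (proj₁ (bl-loc-embed _ i))) (pairOf-first t)
    ... | inj₂ i = embed (second t) i , trans (cong pairOf (proj₁ (bl-loc-embed _ i))) (pairOf-second t)

    positionInPair : Fin Size → ℕ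
    positionInPair j = offsetInPair (bl j) ℕ.+ loc j

  -- Entries forced by E, and the row Gram condition

  fixedPart freeMask : ℤ → ℤ
  fixedPart -[1+ 0 ] = + 1
  fixedPart _        = + 0
  freeMask (+ 0) = + 1
  freeMask _     = + 0

  Binary : ℤ → Set
  Binary x = x ≡ + 0 ⊎ x ≡ + 1

  binary? : ∀ x → Dec (Binary x)
  binary? x = (x ℤ.≟ + 0) ⊎-dec (x ℤ.≟ + 1)

  forced-entry : ∀ {e a} → e ≡ pos ⊎ e ≡ zer ⊎ e ≡ neg → Binary a → Binary (a + e) →
                 a ≡ fixedPart e + freeMask e * a
  forced-entry (inj₁ refl)        (inj₁ refl) _          = refl
  forced-entry (inj₁ refl)        (inj₂ refl) (inj₁ ())
  forced-entry (inj₁ refl)        (inj₂ refl) (inj₂ ())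
  forced-entry (inj₂ (inj₁ refl)) (inj₁ refl) _          = refl
  forced-entry (inj₂ (inj₁ refl)) (inj₂ refl) _          = refl
  forced-entry (inj₂ (inj₂ refl)) (inj₁ refl) (inj₁ ())
  forced-entry (inj₂ (inj₂ refl)) (inj₁ refl) (inj₂ ())
  forced-entry (inj₂ (inj₂ refl)) (inj₂ refl) _          = refl

  freeWeight : Blk → Blk → ℤ
  freeWeight r c = freeMask (sign r c) * side c

  -- `target r (a - b) Λ` is the value the Gram condition forces on twice the signed count of free
  -- ones (`freeSum`) in a row of block r.
  slope offset : Blk → ℤ
  slope  = tabulateᴮ pos neg neg pos pos neg
  offset = tabulateᴮ neg neg neg neg pos pos

  target : Blk → ℤ → ℤ → ℤ
  target r α Λ = slope r * Λ + offset r * α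

  crossSign : Blk → Blk → ℤ
  crossSign r r' = sign r' (first (partner (pairOf r)))

  constDefect : Blk → Blk → Blk → ℤ
  constDefect r r' c = fixedPart (sign r c) * sign r' c + sign r c * fixedPart (sign r' c) + sign r c * sign r' c

  balancedCounts : ℤ → ℤ → ℤ → ℤ → Blk → ℤ
  balancedCounts n₁ n₂ n₃ n₅ = tabulateᴮ n₁ n₂ n₃ (n₁ - n₂ + n₃) n₅ (n₁ - n₂ + n₅)

  Coefficients : Set
  Coefficients = ℤ × ℤ × ℤ × ℤ × ℤ

  linearForm : Coefficients → ℤ → ℤ → ℤ → ℤ → ℤ → ℤ
  linearForm (κ₁ , κ₂ , κ₃ , κ₅ , κΛ) n₁ n₂ n₃ n₅ Λ = n₁ * κ₁ + n₂ * κ₂ + n₃ * κ₃ + n₅ * κ₅ + Λ * κΛ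

  linearForm-zero : ∀ n₁ n₂ n₃ n₅ Λ → linearForm (+ 0 , + 0 , + 0 , + 0 , + 0) n₁ n₂ n₃ n₅ Λ ≡ + 0
  linearForm-zero n₁ n₂ n₃ n₅ Λ
    rewrite ℤP.*-zeroʳ n₁ | ℤP.*-zeroʳ n₂ | ℤP.*-zeroʳ n₃ | ℤP.*-zeroʳ n₅ | ℤP.*-zeroʳ Λ = refl

  defect-expansion : ∀ n₁ n₂ n₃ n₅ Λ D₁ D₂ D₃ D₄ D₅ D₆ c s o c' s' o' →
    + 2 * (n₁ * D₁ + (n₂ * D₂ + (n₃ * D₃ + ((n₁ - n₂ + n₃) * D₄ + (n₅ * D₅ + (n₁ - n₂ + n₅) * D₆)))))
      + c * (s * Λ + o * (n₁ - n₂)) + c' * (s' * Λ + o' * (n₁ - n₂))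
    ≡ n₁ * (+ 2 * (D₁ + D₄ + D₆) + (c * o + c' * o')) + n₂ * (+ 2 * (D₂ - D₄ - D₆) - (c * o + c' * o'))
      + n₃ * (+ 2 * (D₃ + D₄)) + n₅ * (+ 2 * (D₅ + D₆)) + Λ * (c * s + c' * s')
  defect-expansion = solve-∀

  defectCoefficients : Blk → Blk → Coefficients
  defectCoefficients r r' =
    + 2 * (D b₁ + D b₄ + D b₆) + co , + 2 * (D b₂ - D b₄ - D b₆) - co ,
    + 2 * (D b₃ + D b₄) , + 2 * (D b₅ + D b₆) , crossSign r r' * slope r + crossSign r' r * slope r'
    where
    D : Blk → ℤ
    D = constDefect r r'
    co = crossSign r r' * offset r + crossSign r' r * offset r'

  defectCoefficients-zero : ∀ r r' → defectCoefficients r r' ≡ (+ 0 , + 0 , + 0 , + 0 , + 0)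
  defectCoefficients-zero = from-yes (∀ᴮ? λ r → ∀ᴮ? λ r' →
    ≡-dec ℤ._≟_ (≡-dec ℤ._≟_ (≡-dec ℤ._≟_ (≡-dec ℤ._≟_ ℤ._≟_))) (defectCoefficients r r') (+ 0 , + 0 , + 0 , + 0 , + 0))

  -- Once n₄ and n₆ are eliminated by the zero row sums, the doubled defect is a linear form in
  -- n₁, n₂, n₃, n₅, Λ whose five coefficients vanish for each of the 36 pairs of blocks.
  defect-vanishes : ∀ r r' n₁ n₂ n₃ n₅ Λ →
    + 2 * Σᴮ (λ c → balancedCounts n₁ n₂ n₃ n₅ c * constDefect r r' c)
      + crossSign r r' * target r (n₁ - n₂) Λ + crossSign r' r * target r' (n₁ - n₂) Λ ≡ + 0
  defect-vanishes r r' n₁ n₂ n₃ n₅ Λ =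
    trans (defect-expansion n₁ n₂ n₃ n₅ Λ (D b₁) (D b₂) (D b₃) (D b₄) (D b₅) (D b₆)
             (crossSign r r') (slope r) (offset r) (crossSign r' r) (slope r') (offset r'))
    (trans (cong (λ κ → linearForm κ n₁ n₂ n₃ n₅ Λ) (defectCoefficients-zero r r'))
           (linearForm-zero n₁ n₂ n₃ n₅ Λ))
    where
    D : Blk → ℤ
    D = constDefect r r'

  free-cross : ∀ r r' c → freeMask (sign r c) * sign r' c ≡ crossSign r r' * freeWeight r c
  free-cross = from-yes (∀ᴮ? λ r → ∀ᴮ? λ r' → ∀ᴮ? λ c →
    freeMask (sign r c) * sign r' c ℤ.≟ crossSign r r' * freeWeight r c)

  crossSign-nonzero : ∀ r r' → pairOf r ≡ π₁ → pairOf r' ≡ π₁ ⊎ (crossSign r r' ≢ + 0 × crossSign r' r ≢ + 0)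
  crossSign-nonzero = from-yes (∀ᴮ? λ r → ∀ᴮ? λ r' → (pairOf r ≟ᴾ π₁) →-dec
    ((pairOf r' ≟ᴾ π₁) ⊎-dec (¬? (crossSign r r' ℤ.≟ + 0) ×-dec ¬? (crossSign r' r ℤ.≟ + 0))))

  slope-involutive : ∀ r x → slope r * (slope r * x) ≡ x
  slope-involutive r x = trans (sym (ℤP.*-assoc (slope r) (slope r) x))
    (trans (cong (_* x) (from-yes (∀ᴮ? λ r → slope r * slope r ℤ.≟ + 1) r)) (ℤP.*-identityˡ x))

  entry-expansion : ∀ {a a' e e' f f' m m' q q' w w'} →
    a ≡ f + m * a → a' ≡ f' + m' * a' → m * e' ≡ q * w → m' * e ≡ q' * w' →
    (a + e) * (a' + e') ≡ a * a' + ((f * e' + e * f' + e * e') + q * (w * a) + q' * (w' * a'))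
  entry-expansion {a} {a'} {e} {e'} {f} {f'} {m} {m'} {q} {q'} {w} {w'} ha ha' hm hm' = begin
    (a + e) * (a' + e')                                    ≡⟨ expand a a' e e' ⟩
    a * a' + (a * e' + e * a' + e * e')                    ≡⟨ cong₂ (λ x y → a * a' + (x + y + e * e'))
                                                                (cong (_* e') ha) (cong (e *_) ha') ⟩
    a * a' + ((f + m * a) * e' + e * (f' + m' * a') + e * e') ≡⟨ regroup a a' e e' f f' m m' ⟩
    a * a' + ((f * e' + e * f' + e * e') + m * e' * a + m' * e * a')
      ≡⟨ cong₂ (λ x y → a * a' + ((f * e' + e * f' + e * e') + x * a + y * a')) hm hm' ⟩
    a * a' + ((f * e' + e * f' + e * e') + q * w * a + q' * w' * a')
      ≡⟨ cong₂ (λ x y → a * a' + ((f * e' + e * f' + e * e') + x + y))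
           (ℤP.*-assoc q w a) (ℤP.*-assoc q' w' a') ⟩
    a * a' + ((f * e' + e * f' + e * e') + q * (w * a) + q' * (w' * a')) ∎
    where
    open ≡-Reasoning
    expand : ∀ a a' e e' → (a + e) * (a' + e') ≡ a * a' + (a * e' + e * a' + e * e')
    expand = solve-∀
    regroup : ∀ a a' e e' f f' m m' →
      a * a' + ((f + m * a) * e' + e * (f' + m' * a') + e * e')
        ≡ a * a' + ((f * e' + e * f' + e * e') + m * e' * a + m' * e * a')
    regroup = solve-∀

  -- Used for the rows of E and, since `sign` is symmetric, for the rows of Eᵀ.
  module GramRows {M N : ℕ} (rb : Fin M → Blk) (cb : Fin N → Blk) (n : Blk → ℤ)
    (∑-count : ∀ (g : Blk → ℤ) → ∑ (λ j → g (cb j)) ≡ Σᴮ (λ c → n c * g c))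
    (balance₂ : n b₁ - n b₂ + (n b₃ - n b₄) ≡ + 0)
    (balance₃ : n b₁ - n b₂ + (n b₅ - n b₆) ≡ + 0)
    (E : Matrix M N) (E-sign : ∀ i j → E i j ≡ sign (rb i) (cb j)) where

    α : ℤ
    α = n b₁ - n b₂

    freeSum : Matrix M N → Fin M → ℤ
    freeSum A i = ∑ (λ j → freeWeight (rb i) (cb j) * A i j)

    Forced : Matrix M N → Set
    Forced A = ∀ i j → A i j ≡ fixedPart (sign (rb i) (cb j)) + freeMask (sign (rb i) (cb j)) * A i j

    forced : ∀ A → IsBinary A → IsBinary (A ⊕ E) → Forced A
    forced A A-bin B-bin i j = forced-entry (sign-values (rb i) (cb j)) (A-bin i j)
      (subst (λ e → Binary (A i j + e)) (E-sign i j) (B-bin i j))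

    constPart : Blk → Blk → ℤ
    constPart r r' = Σᴮ (λ c → n c * constDefect r r' c)

    defect : Blk → Blk → ℤ → ℤ → ℤ
    defect r r' X X' = constPart r r' + crossSign r r' * X + crossSign r' r * X'

    gram-defect : ∀ A → Forced A → ∀ i i' →
      ((A ⊕ E) ⊗ transpose (A ⊕ E)) i i' ≡ (A ⊗ transpose A) i i' + defect (rb i) (rb i') (freeSum A i) (freeSum A i')
    gram-defect A A-forced i i' = begin
      ∑ (λ t → (A i t + E i t) * (A i' t + E i' t))
        ≡⟨ ∑-cong entrywise ⟩
      ∑ (λ t → A i t * A i' t + (K (cb t) + q * (w t * A i t) + q' * (w' t * A i' t)))
        ≡⟨ ∑-distrib-+ (λ t → A i t * A i' t) _ ⟩
      (A ⊗ transpose A) i i' + ∑ (λ t → K (cb t) + q * (w t * A i t) + q' * (w' t * A i' t))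
        ≡⟨ cong (_+_ ((A ⊗ transpose A) i i')) (trans (∑-distrib-+ _ (λ t → q' * (w' t * A i' t)))
             (cong₂ _+_ (trans (∑-distrib-+ (λ t → K (cb t)) _)
                               (cong₂ _+_ (∑-count K) (sym (*-distribˡ-∑ {N} q _))))
                        (sym (*-distribˡ-∑ {N} q' _)))) ⟩
      (A ⊗ transpose A) i i' + defect r r' (freeSum A i) (freeSum A i') ∎
      where
      open ≡-Reasoning
      r = rb i
      r' = rb i'
      K = constDefect r r'
      q = crossSign r r'
      q' = crossSign r' r
      w w' : Fin N → ℤ
      w t = freeWeight r (cb t)
      w' t = freeWeight r' (cb t)
      entrywise : ∀ t → (A i t + E i t) * (A i' t + E i' t)
                      ≡ A i t * A i' t + (K (cb t) + q * (w t * A i t) + q' * (w' t * A i' t))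
      entrywise t rewrite E-sign i t | E-sign i' t =
        entry-expansion {f = fixedPart (sign r (cb t))} {fixedPart (sign r' (cb t))}
                        {freeMask (sign r (cb t))} {freeMask (sign r' (cb t))} {q} {q'} {w t} {w' t}
          (A-forced i t) (A-forced i' t) (free-cross r r' (cb t)) (free-cross r' r (cb t))

    target-vanishing : ∀ r r' Λ → + 2 * constPart r r' + crossSign r r' * target r α Λ + crossSign r' r * target r' α Λ ≡ + 0
    target-vanishing r r' Λ = trans (cong (λ K → + 2 * K + crossSign r r' * target r α Λ + crossSign r' r * target r' α Λ)
                                          (Σᴮ-cong (λ c → cong (_* constDefect r r' c) (balanced c))))
                                    (defect-vanishes r r' (n b₁) (n b₂) (n b₃) (n b₅) Λ)
      where
      solve-for : ∀ x y z w → x - y + (z - w) ≡ + 0 → w ≡ x - y + z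
      solve-for x y z w h = trans (eliminate x y z w) (trans (cong (_-_ (x - y + z)) h) (ℤP.+-identityʳ _))
        where
        eliminate : ∀ x y z w → w ≡ x - y + z - (x - y + (z - w))
        eliminate = solve-∀
      balanced : ∀ c → n c ≡ balancedCounts (n b₁) (n b₂) (n b₃) (n b₅) c
      balanced = tabulateᴮ refl refl refl (solve-for (n b₁) (n b₂) (n b₃) (n b₄) balance₂)
                             refl (solve-for (n b₁) (n b₂) (n b₅) (n b₆) balance₃)

    twice-defect : ∀ r r' X X' Λ → + 2 * defect r r' X X'
      ≡ crossSign r r' * (+ 2 * X - target r α Λ) + crossSign r' r * (+ 2 * X' - target r' α Λ)
    twice-defect r r' X X' Λ = begin
      + 2 * defect r r' X X'                               ≡⟨ rearrange (constPart r r') q q' X X' t t' ⟩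
      q * (+ 2 * X - t) + q' * (+ 2 * X' - t') + (+ 2 * constPart r r' + q * t + q' * t')
                                                           ≡⟨ cong (_+_ (q * (+ 2 * X - t) + q' * (+ 2 * X' - t')))
                                                                   (target-vanishing r r' Λ) ⟩
      q * (+ 2 * X - t) + q' * (+ 2 * X' - t') + + 0        ≡⟨ ℤP.+-identityʳ _ ⟩
      q * (+ 2 * X - t) + q' * (+ 2 * X' - t') ∎
      where
      open ≡-Reasoning
      q = crossSign r r'
      q' = crossSign r' r
      t = target r α Λ
      t' = target r' α Λ
      rearrange : ∀ K q q' X X' t t' → + 2 * (K + q * X + q' * X')
        ≡ q * (+ 2 * X - t) + q' * (+ 2 * X' - t') + (+ 2 * K + q * t + q' * t')
      rearrange = solve-∀

    gram-sufficient : ∀ A → Forced A → ∀ Λ → (∀ i → + 2 * freeSum A i ≡ target (rb i) α Λ) →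
                      (A ⊗ transpose A) ≐ ((A ⊕ E) ⊗ transpose (A ⊕ E))
    gram-sufficient A A-forced Λ on-target i i' =
      sym (trans (gram-defect A A-forced i i') (trans (cong (_+_ ((A ⊗ transpose A) i i')) defect≡0) (ℤP.+-identityʳ _)))
      where
      defect≡0 : defect (rb i) (rb i') (freeSum A i) (freeSum A i') ≡ + 0
      defect≡0 = ℤP.*-cancelˡ-≡ (+ 2) _ (+ 0) (begin
        + 2 * defect (rb i) (rb i') (freeSum A i) (freeSum A i')
          ≡⟨ twice-defect (rb i) (rb i') (freeSum A i) (freeSum A i') Λ ⟩
        crossSign (rb i) (rb i') * (+ 2 * freeSum A i - target (rb i) α Λ)
          + crossSign (rb i') (rb i) * (+ 2 * freeSum A i' - target (rb i') α Λ)
          ≡⟨ cong₂ (λ x y → crossSign (rb i) (rb i') * x + crossSign (rb i') (rb i) * y)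
                   (ℤP.i≡j⇒i-j≡0 (on-target i)) (ℤP.i≡j⇒i-j≡0 (on-target i')) ⟩
        crossSign (rb i) (rb i') * + 0 + crossSign (rb i') (rb i) * + 0
          ≡⟨ cong₂ _+_ (ℤP.*-zeroʳ (crossSign (rb i) (rb i'))) (ℤP.*-zeroʳ (crossSign (rb i') (rb i))) ⟩
        + 0 ∎)
        where open ≡-Reasoning

    parameter : Blk → ℤ → ℤ
    parameter r X = slope r * (+ 2 * X - offset r * α)

    target-parameter : ∀ r X → target r α (parameter r X) ≡ + 2 * X
    target-parameter r X = trans (cong (λ x → x + offset r * α) (slope-involutive r _)) (minus-plus _ _)
      where
      minus-plus : ∀ x y → x - y + y ≡ x
      minus-plus = solve-∀

    parameter-target : ∀ r X Λ → + 2 * X ≡ target r α Λ → parameter r X ≡ Λ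
    parameter-target r X Λ eq = trans (cong (λ x → slope r * (x - offset r * α)) eq)
      (trans (cong (slope r *_) (plus-minus _ _)) (slope-involutive r Λ))
      where
      plus-minus : ∀ x y → x + y - y ≡ x
      plus-minus = solve-∀

    gram-transfer : ∀ r r' X X' → defect r r' X X' ≡ + 0 → crossSign r' r ≢ + 0 →
                    + 2 * X' ≡ target r' α (parameter r X)
    gram-transfer r r' X X' defect≡0 q'≢0 = ℤP.i-j≡0⇒i≡j _ _ (ℤP.*-cancelˡ-≡ q' _ (+ 0) {{ℤ.≢-nonZero q'≢0}} (begin
      q' * (+ 2 * X' - t')                              ≡⟨ solve-left q (+ 2 * X - target r α Λ) q' (+ 2 * X' - t') ⟩
      q * (+ 2 * X - target r α Λ) + q' * (+ 2 * X' - t') - q * (+ 2 * X - target r α Λ)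
        ≡⟨ cong₂ (λ x y → x - q * y) (sym (twice-defect r r' X X' Λ)) (ℤP.i≡j⇒i-j≡0 (sym (target-parameter r X))) ⟩
      + 2 * defect r r' X X' - q * + 0                 ≡⟨ cong₂ (λ x y → + 2 * x - y) defect≡0 (ℤP.*-zeroʳ q) ⟩
      + 0                                              ≡⟨ sym (ℤP.*-zeroʳ q') ⟩
      q' * + 0 ∎))
      where
      open ≡-Reasoning
      Λ = parameter r X
      q = crossSign r r'
      q' = crossSign r' r
      t' = target r' α Λ
      solve-left : ∀ q x q' y → q' * y ≡ q * x + q' * y - q * x
      solve-left = solve-∀

    gram-necessary : ∀ A → Forced A → (A ⊗ transpose A) ≐ ((A ⊕ E) ⊗ transpose (A ⊕ E)) →
      ∀ i₁ i₀ → pairOf (rb i₁) ≡ π₁ → pairOf (rb i₀) ≢ π₁ →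
      ∀ i → + 2 * freeSum A i ≡ target (rb i) α (parameter (rb i₁) (freeSum A i₁))
    gram-necessary A A-forced gram i₁ i₀ i₁∈π₁ i₀∉π₁ = on-target
      where
      X = freeSum A
      defect≡0 : ∀ i i' → defect (rb i) (rb i') (X i) (X i') ≡ + 0
      defect≡0 i i' = identityʳ-unique _ _ (sym (trans (gram i i') (gram-defect A A-forced i i')))
      transfer : ∀ i i' → pairOf (rb i) ≡ π₁ → pairOf (rb i') ≢ π₁ →
                 + 2 * X i' ≡ target (rb i') α (parameter (rb i) (X i))
               × + 2 * X i ≡ target (rb i) α (parameter (rb i') (X i'))
      transfer i i' i∈π₁ i'∉π₁ with crossSign-nonzero (rb i) (rb i') i∈π₁
      ... | inj₁ i'∈π₁ = contradiction i'∈π₁ i'∉π₁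
      ... | inj₂ (q≢0 , q'≢0) = gram-transfer (rb i) (rb i') (X i) (X i') (defect≡0 i i') q'≢0 ,
                                gram-transfer (rb i') (rb i) (X i') (X i) (defect≡0 i' i) q≢0
      on-target : ∀ i → + 2 * X i ≡ target (rb i) α (parameter (rb i₁) (X i₁))
      on-target i with pairOf (rb i) ≟ᴾ π₁
      ... | no i∉π₁ = proj₁ (transfer i₁ i i₁∈π₁ i∉π₁)
      ... | yes i∈π₁ = trans (proj₂ (transfer i i₀ i∈π₁ i₀∉π₁))
        (cong (target (rb i) α) (parameter-target (rb i₀) (X i₀) _ (proj₁ (transfer i₁ i₀ i₁∈π₁ i₀∉π₁))))

    ∑-weighted : ∀ A (wr wc : Blk → ℤ) → (∀ r c → wr r * freeWeight r c ≡ wr r * wc c) →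
      ∑ (λ i → wr (rb i) * freeSum A i) ≡ ∑ (λ i → ∑ (λ j → wr (rb i) * wc (cb j) * A i j))
    ∑-weighted A wr wc compatible = ∑-cong λ i → trans (*-distribˡ-∑ {N} (wr (rb i)) _) (∑-cong λ j →
      trans (sym (ℤP.*-assoc (wr (rb i)) _ (A i j))) (cong (_* A i j) (compatible (rb i) (cb j))))

  -- Necessity

  signedSum₂ : ∀ r (n : Blk → ℤ) → pairOf r ≡ π₁ → Σᴮ (λ c → n c * sign r c) ≡ + 0 → n b₁ - n b₂ + (n b₃ - n b₄) ≡ + 0
  signedSum₂ b₁ n _ h = trans (expand (n b₁) (n b₂) (n b₃) (n b₄) (n b₅) (n b₆)) h
    where
    expand : ∀ n₁ n₂ n₃ n₄ n₅ n₆ → n₁ - n₂ + (n₃ - n₄)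
      ≡ n₁ * pos + (n₂ * neg + (n₃ * pos + (n₄ * neg + (n₅ * zer + n₆ * zer))))
    expand = solve-∀
  signedSum₂ b₂ n _ h = trans (expand (n b₁) (n b₂) (n b₃) (n b₄) (n b₅) (n b₆)) (cong -_ h)
    where
    expand : ∀ n₁ n₂ n₃ n₄ n₅ n₆ → n₁ - n₂ + (n₃ - n₄)
      ≡ - (n₁ * neg + (n₂ * pos + (n₃ * neg + (n₄ * pos + (n₅ * zer + n₆ * zer)))))
    expand = solve-∀
  signedSum₂ b₃ n () h
  signedSum₂ b₄ n () h
  signedSum₂ b₅ n () h
  signedSum₂ b₆ n () h

  signedSum₃ : ∀ r (n : Blk → ℤ) → pairOf r ≡ π₂ → Σᴮ (λ c → n c * sign r c) ≡ + 0 → n b₁ - n b₂ + (n b₅ - n b₆) ≡ + 0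
  signedSum₃ b₃ n _ h = trans (expand (n b₁) (n b₂) (n b₃) (n b₄) (n b₅) (n b₆)) h
    where
    expand : ∀ n₁ n₂ n₃ n₄ n₅ n₆ → n₁ - n₂ + (n₅ - n₆)
      ≡ n₁ * pos + (n₂ * neg + (n₃ * zer + (n₄ * zer + (n₅ * pos + n₆ * neg))))
    expand = solve-∀
  signedSum₃ b₄ n _ h = trans (expand (n b₁) (n b₂) (n b₃) (n b₄) (n b₅) (n b₆)) (cong -_ h)
    where
    expand : ∀ n₁ n₂ n₃ n₄ n₅ n₆ → n₁ - n₂ + (n₅ - n₆)
      ≡ - (n₁ * neg + (n₂ * pos + (n₃ * zer + (n₄ * zer + (n₅ * neg + n₆ * pos)))))
    expand = solve-∀
  signedSum₃ b₁ n () h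
  signedSum₃ b₂ n () h
  signedSum₃ b₅ n () h
  signedSum₃ b₆ n () h

  pairSlope pairOffset : Pair → ℤ
  pairSlope t = slope (first t)
  pairOffset t = offset (first t)

  second-slope-offset : ∀ t → slope (second t) ≡ - pairSlope t × offset (second t) ≡ pairOffset t
  second-slope-offset π₁ = refl , refl
  second-slope-offset π₂ = refl , refl
  second-slope-offset π₃ = refl , refl

  pairSlope-partner : ∀ t → pairSlope (partner t) ≡ pairSlope t
  pairSlope-partner π₁ = refl
  pairSlope-partner π₂ = refl
  pairSlope-partner π₃ = refl

  pairSize pairDiff : (Blk → ℤ) → Pair → ℤ
  pairSize m t = m (first t) + m (second t)
  pairDiff m t = m (first t) - m (second t)

  pairWeight-compatible : ∀ t r c → pairWeight t r * freeWeight r c ≡ pairWeight t r * pairWeight (partner t) c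
  pairWeight-compatible π₁ = from-yes (∀ᴮ? λ r → ∀ᴮ? λ c →
    pairWeight π₁ r * freeWeight r c ℤ.≟ pairWeight π₁ r * pairWeight π₃ c)
  pairWeight-compatible π₂ = from-yes (∀ᴮ? λ r → ∀ᴮ? λ c →
    pairWeight π₂ r * freeWeight r c ℤ.≟ pairWeight π₂ r * pairWeight π₂ c)
  pairWeight-compatible π₃ = from-yes (∀ᴮ? λ r → ∀ᴮ? λ c →
    pairWeight π₃ r * freeWeight r c ℤ.≟ pairWeight π₃ r * pairWeight π₁ c)

  weighted-target : ∀ t (m : Blk → ℤ) α Λ → Σᴮ (λ b → m b * (pairWeight t b * target b α Λ))
    ≡ pairSlope t * (pairSize m t * Λ) + pairOffset t * (pairDiff m t * α)
  weighted-target t m α Λ = begin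
    Σᴮ (λ b → m b * (pairWeight t b * target b α Λ))
      ≡⟨ Σᴮ-cong (λ b → swap (m b) (pairWeight t b) (target b α Λ)) ⟩
    Σᴮ (λ b → pairWeight t b * (m b * target b α Λ))
      ≡⟨ Σᴮ-pairWeight t (λ b → m b * target b α Λ) ⟩
    m₁ * (σ * Λ + o * α) - m₂ * (slope (second t) * Λ + offset (second t) * α)
      ≡⟨ cong₂ (λ s o′ → m₁ * (σ * Λ + o * α) - m₂ * (s * Λ + o′ * α))
               (proj₁ (second-slope-offset t)) (proj₂ (second-slope-offset t)) ⟩
    m₁ * (σ * Λ + o * α) - m₂ * (- σ * Λ + o * α)
      ≡⟨ collect m₁ m₂ σ o α Λ ⟩
    σ * ((m₁ + m₂) * Λ) + o * ((m₁ - m₂) * α) ∎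
    where
    open ≡-Reasoning
    m₁ = m (first t)
    m₂ = m (second t)
    σ = pairSlope t
    o = pairOffset t
    swap : ∀ x y z → x * (y * z) ≡ y * (x * z)
    swap = solve-∀
    collect : ∀ m₁ m₂ σ o α Λ → m₁ * (σ * Λ + o * α) - m₂ * (- σ * Λ + o * α) ≡ σ * ((m₁ + m₂) * Λ) + o * ((m₁ - m₂) * α)
    collect = solve-∀

  doubled-weighted-sum : ∀ {M} (bl : Fin M → Blk) (m : Blk → ℤ) →
    (∀ (g : Blk → ℤ) → ∑ (λ i → g (bl i)) ≡ Σᴮ (λ x → m x * g x)) →
    ∀ (X : Fin M → ℤ) α Λ → (∀ i → + 2 * X i ≡ target (bl i) α Λ) → ∀ t →
    + 2 * ∑ (λ i → pairWeight t (bl i) * X i) ≡ pairSlope t * (pairSize m t * Λ) + pairOffset t * (pairDiff m t * α)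
  doubled-weighted-sum {M} bl m ∑-count X α Λ on-target t = begin
    + 2 * ∑ (λ i → pairWeight t (bl i) * X i)            ≡⟨ *-distribˡ-∑ {M} (+ 2) _ ⟩
    ∑ (λ i → + 2 * (pairWeight t (bl i) * X i))
      ≡⟨ ∑-cong (λ i → trans (swap-factors (+ 2) (pairWeight t (bl i)) (X i)) (cong (pairWeight t (bl i) *_) (on-target i))) ⟩
    ∑ (λ i → pairWeight t (bl i) * target (bl i) α Λ)    ≡⟨ ∑-count (λ x → pairWeight t x * target x α Λ) ⟩
    Σᴮ (λ x → m x * (pairWeight t x * target x α Λ))     ≡⟨ weighted-target t m α Λ ⟩
    pairSlope t * (pairSize m t * Λ) + pairOffset t * (pairDiff m t * α) ∎
    where
    open ≡-Reasoning
    swap-factors : ∀ x y z → x * (y * z) ≡ y * (x * z)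
    swap-factors = solve-∀

  offset-balance : ∀ (n : Blk → ℤ) → n b₁ - n b₂ + (n b₃ - n b₄) ≡ + 0 → n b₁ - n b₂ + (n b₅ - n b₆) ≡ + 0 →
                   ∀ x → pairDiff n (partner (pairOf x)) ≡ offset x * (n b₁ - n b₂)
  offset-balance n _ balance₃ b₁ = trans (inverseʳ-unique _ _ balance₃) (sym (ℤP.-1*i≡-i _))
  offset-balance n _ balance₃ b₂ = trans (inverseʳ-unique _ _ balance₃) (sym (ℤP.-1*i≡-i _))
  offset-balance n balance₂ _ b₃ = trans (inverseʳ-unique _ _ balance₂) (sym (ℤP.-1*i≡-i _))
  offset-balance n balance₂ _ b₄ = trans (inverseʳ-unique _ _ balance₂) (sym (ℤP.-1*i≡-i _))
  offset-balance n _ _ b₅ = sym (ℤP.*-identityˡ _)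
  offset-balance n _ _ b₆ = sym (ℤP.*-identityˡ _)

  parameter-parity : ∀ r α X → pairOf r ≡ π₁ → Σ ℤ λ w → slope r * (+ 2 * X - offset r * α) ≡ α + + 2 * w
  parameter-parity b₁ α X _ = X , expand α X
    where
    expand : ∀ α X → pos * (+ 2 * X - neg * α) ≡ α + + 2 * X
    expand = solve-∀
  parameter-parity b₂ α X _ = - X - α , expand α X
    where
    expand : ∀ α X → neg * (+ 2 * X - neg * α) ≡ α + + 2 * (- X - α)
    expand = solve-∀

  Condition : (a b c d e f k l p q r s : ℕ) → Set
  Condition a b c d e f k l p q r s =
    (2 ∣ (a ℕ.+ b) × 2 ∣ (c ℕ.+ d) × 2 ∣ (e ℕ.+ f) × 2 ∣ (k ℕ.+ l) × 2 ∣ (p ℕ.+ q) × 2 ∣ (r ℕ.+ s))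
    ⊎ (((¬ 2 ∣ (a ℕ.+ b) × ¬ 2 ∣ (c ℕ.+ d) × ¬ 2 ∣ (e ℕ.+ f))
        ⊎ (¬ 2 ∣ (k ℕ.+ l) × ¬ 2 ∣ (p ℕ.+ q) × ¬ 2 ∣ (r ℕ.+ s)))
       × ((e ℕ.+ f) ℕ.* (p ℕ.+ q) ≡ (c ℕ.+ d) ℕ.* (k ℕ.+ l))
       × ((c ℕ.+ d) ℕ.* (r ℕ.+ s) ≡ (a ℕ.+ b) ℕ.* (p ℕ.+ q)))

  ∣-from-ℤ : ∀ d n w → + n ≡ + d * w → d ∣ n
  ∣-from-ℤ d n w eq = divides ℤ.∣ w ∣ (trans (cong ℤ.∣_∣ eq) (trans (ℤP.abs-* (+ d) w) (ℕP.*-comm d ℤ.∣ w ∣)))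

  pairs-same-parity : ∀ a b c d → + a - + b + (+ c - + d) ≡ + 0 → 2 ∣ (a ℕ.+ b) ℕ.+ (c ℕ.+ d)
  pairs-same-parity a b c d balance = ∣-from-ℤ 2 _ (+ b + + d) (begin
    + ((a ℕ.+ b) ℕ.+ (c ℕ.+ d))             ≡⟨ ℤP.pos-+ (a ℕ.+ b) (c ℕ.+ d) ⟩
    + (a ℕ.+ b) + + (c ℕ.+ d)               ≡⟨ cong₂ _+_ (ℤP.pos-+ a b) (ℤP.pos-+ c d) ⟩
    + a + + b + (+ c + + d)                 ≡⟨ regroup (+ a) (+ b) (+ c) (+ d) ⟩
    + a - + b + (+ c - + d) + + 2 * (+ b + + d) ≡⟨ cong (λ x → x + + 2 * (+ b + + d)) balance ⟩
    + 0 + + 2 * (+ b + + d)                 ≡⟨ ℤP.+-identityˡ _ ⟩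
    + 2 * (+ b + + d) ∎)
    where
    open ≡-Reasoning
    regroup : ∀ a b c d → a + b + (c + d) ≡ a - b + (c - d) + + 2 * (b + d)
    regroup = solve-∀

  ∣m+n∣n⇒∣m : ∀ {d m n} → d ∣ m ℕ.+ n → d ∣ n → d ∣ m
  ∣m+n∣n⇒∣m {d} {m} {n} d∣m+n = ∣m+n∣m⇒∣n (subst (d ∣_) (ℕP.+-comm m n) d∣m+n)

  odd-parameter-nonzero : ∀ a b Λ w → Λ ≡ + a - + b + + 2 * w → ¬ 2 ∣ a ℕ.+ b → Λ ≢ + 0
  odd-parameter-nonzero a b Λ w parity odd refl = odd (∣-from-ℤ 2 _ (+ b - w) (begin
    + (a ℕ.+ b)                   ≡⟨ ℤP.pos-+ a b ⟩
    + a + + b                     ≡⟨ regroup (+ a) (+ b) w ⟩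
    + a - + b + + 2 * w + + 2 * (+ b - w) ≡⟨ cong (λ x → x + + 2 * (+ b - w)) (sym parity) ⟩
    + 0 + + 2 * (+ b - w)         ≡⟨ ℤP.+-identityˡ _ ⟩
    + 2 * (+ b - w) ∎))
    where
    open ≡-Reasoning
    regroup : ∀ a b w → a + b ≡ a - b + + 2 * w + + 2 * (b - w)
    regroup = solve-∀

  nonzero-transfer : ∀ {X Y Λ Λ'} → X * Λ ≡ Y * Λ' → X ≢ + 0 → Λ ≢ + 0 → Λ' ≢ + 0
  nonzero-transfer {X} {Y} {Λ} eq X≢0 Λ≢0 refl with ℤP.i*j≡0⇒i≡0∨j≡0 X (trans eq (ℤP.*-zeroʳ Y))
  ... | inj₁ X≡0 = X≢0 X≡0
  ... | inj₂ Λ≡0 = Λ≢0 Λ≡0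

  cross-multiply : ∀ {X Y X' Y' Λ Λ'} → X * Λ ≡ Y * Λ' → X' * Λ ≡ Y' * Λ' → Λ' ≢ + 0 → Y * X' ≡ Y' * X
  cross-multiply {X} {Y} {X'} {Y'} {Λ} {Λ'} eq eq' Λ'≢0 = ℤP.*-cancelʳ-≡ _ _ Λ' {{ℤ.≢-nonZero Λ'≢0}} (begin
    Y * X' * Λ'     ≡⟨ shuffle Y X' Λ' ⟩
    X' * (Y * Λ')   ≡⟨ cong (X' *_) (sym eq) ⟩
    X' * (X * Λ)    ≡⟨ shuffle′ X' X Λ ⟩
    X * (X' * Λ)    ≡⟨ cong (X *_) eq' ⟩
    X * (Y' * Λ')   ≡⟨ shuffle″ X Y' Λ' ⟩
    Y' * X * Λ' ∎)
    where
    open ≡-Reasoning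
    shuffle : ∀ y x l → y * x * l ≡ x * (y * l)
    shuffle = solve-∀
    shuffle′ : ∀ x x' l → x * (x' * l) ≡ x' * (x * l)
    shuffle′ = solve-∀
    shuffle″ : ∀ x y l → x * (y * l) ≡ y * x * l
    shuffle″ = solve-∀

  pos-pairs : ∀ x y u v → (+ x + + y) * (+ u + + v) ≡ + ((x ℕ.+ y) ℕ.* (u ℕ.+ v))
  pos-pairs x y u v = sym (trans (ℤP.pos-* (x ℕ.+ y) (u ℕ.+ v)) (cong₂ _*_ (ℤP.pos-+ x y) (ℤP.pos-+ u v)))

  -- Circulant (0,1) matrices

  sumℕ : ℕ → (ℕ → ℕ) → ℕ
  sumℕ zero    g = 0
  sumℕ (suc n) g = g 0 ℕ.+ sumℕ n (λ t → g (suc t))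

  sumℕ-cong : ∀ n {g h : ℕ → ℕ} → (∀ t → t ℕ.< n → g t ≡ h t) → sumℕ n g ≡ sumℕ n h
  sumℕ-cong zero    g≗h = refl
  sumℕ-cong (suc n) g≗h = cong₂ ℕ._+_ (g≗h 0 z<s) (sumℕ-cong n (λ t t<n → g≗h (suc t) (s<s t<n)))

  sumℕ-+ : ∀ m n (g : ℕ → ℕ) → sumℕ (m ℕ.+ n) g ≡ sumℕ m g ℕ.+ sumℕ n (λ t → g (m ℕ.+ t))
  sumℕ-+ zero    n g = refl
  sumℕ-+ (suc m) n g = trans (cong (g 0 ℕ.+_) (sumℕ-+ m n (λ t → g (suc t)))) (sym (ℕP.+-assoc (g 0) _ _))

  sumℕ-distrib : ∀ n (g h : ℕ → ℕ) → sumℕ n (λ t → g t ℕ.+ h t) ≡ sumℕ n g ℕ.+ sumℕ n h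
  sumℕ-distrib zero    g h = refl
  sumℕ-distrib (suc n) g h = trans (cong (g 0 ℕ.+ h 0 ℕ.+_) (sumℕ-distrib n (λ t → g (suc t)) (λ t → h (suc t))))
                                   (interchange (g 0) (h 0) _ _)

  sumℕ-const : ∀ n c → sumℕ n (λ _ → c) ≡ n ℕ.* c
  sumℕ-const zero    c = refl
  sumℕ-const (suc n) c = cong (c ℕ.+_) (sumℕ-const n c)

  sumℕ-comm : ∀ m n (f : ℕ → ℕ → ℕ) → sumℕ m (λ x → sumℕ n (f x)) ≡ sumℕ n (λ y → sumℕ m (λ x → f x y))
  sumℕ-comm zero    n f = sym (trans (sumℕ-const n 0) (ℕP.*-zeroʳ n))
  sumℕ-comm (suc m) n f = trans (cong (sumℕ n (f 0) ℕ.+_) (sumℕ-comm m n (λ x → f (suc x))))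
                                (sym (sumℕ-distrib n (f 0) _))

  sumℕ-mono : ∀ {m n} (g : ℕ → ℕ) → m ℕ.≤ n → sumℕ m g ℕ.≤ sumℕ n g
  sumℕ-mono {m} {n} g m≤n = subst (λ k → sumℕ m g ℕ.≤ sumℕ k g) (ℕP.m+[n∸m]≡n m≤n)
    (subst (sumℕ m g ℕ.≤_) (sym (sumℕ-+ m (n ℕ.∸ m) g)) (ℕP.m≤m+n _ _))

  sumℕ-blocks : ∀ m R (g : ℕ → ℕ) → sumℕ (m ℕ.* R) g ≡ sumℕ m (λ x → sumℕ R (λ s → g (x ℕ.* R ℕ.+ s)))
  sumℕ-blocks zero    R g = refl
  sumℕ-blocks (suc m) R g = trans (sumℕ-+ R (m ℕ.* R) g) (cong (sumℕ R g ℕ.+_) (trans (sumℕ-blocks m R (λ t → g (R ℕ.+ t)))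
    (sumℕ-cong m (λ x _ → sumℕ-cong R (λ s _ → cong g (sym (ℕP.+-assoc R (x ℕ.* R) s)))))))

  sumℕ-last : ∀ n (f : ℕ → ℕ) → sumℕ (suc n) f ≡ sumℕ n f ℕ.+ f n
  sumℕ-last zero    f = ℕP.+-identityʳ (f 0)
  sumℕ-last (suc n) f = trans (cong (f 0 ℕ.+_) (sumℕ-last n (λ t → f (suc t)))) (sym (ℕP.+-assoc (f 0) _ _))

  sumℕ-rotate : ∀ n (h : ℕ → ℕ) c → h (c ℕ.+ n) ≡ h c → sumℕ n (λ s → h (suc c ℕ.+ s)) ≡ sumℕ n (λ s → h (c ℕ.+ s))
  sumℕ-rotate zero    h c _ = refl
  sumℕ-rotate (suc n) h c periodic = begin
    sumℕ (suc n) (λ s → h (suc c ℕ.+ s))              ≡⟨ sumℕ-last n (λ s → h (suc c ℕ.+ s)) ⟩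
    sumℕ n (λ s → h (suc c ℕ.+ s)) ℕ.+ h (suc c ℕ.+ n) ≡⟨ cong₂ ℕ._+_ (sumℕ-cong n (λ s _ → cong h (sym (ℕP.+-suc c s))))
                                                          (trans (cong h (sym (ℕP.+-suc c n))) periodic) ⟩
    sumℕ n (λ s → h (c ℕ.+ suc s)) ℕ.+ h c             ≡⟨ ℕP.+-comm _ (h c) ⟩
    h c ℕ.+ sumℕ n (λ s → h (c ℕ.+ suc s))
      ≡⟨ cong (λ x → h x ℕ.+ sumℕ n (λ s → h (c ℕ.+ suc s))) (sym (ℕP.+-identityʳ c)) ⟩
    sumℕ (suc n) (λ s → h (c ℕ.+ s)) ∎
    where open ≡-Reasoning

  hit : ℕ → ℕ → ℕ
  hit u y = if u ≡ᵇ y then 1 else 0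

  hit-sym : ∀ u y → hit u y ≡ hit y u
  hit-sym zero    zero    = refl
  hit-sym zero    (suc y) = refl
  hit-sym (suc u) zero    = refl
  hit-sym (suc u) (suc y) = hit-sym u y

  hit-once : ∀ n u → u ℕ.< n → sumℕ n (hit u) ≡ 1
  hit-once (suc n) zero    _         = cong suc (trans (sumℕ-const n 0) (ℕP.*-zeroʳ n))
  hit-once (suc n) (suc u) (s<s u<n) = hit-once n u u<n

  -- Row x covers the R consecutive residues xR, …, xR + R - 1 modulo n.
  module Cyclic (m n R C : ℕ) .{{_ : NonZero n}} (mR≡nC : m ℕ.* R ≡ n ℕ.* C) (R≤n : R ℕ.≤ n) where

    covers : ℕ → ℕ → ℕ
    covers y t = hit (t % n) (y % n)

    cell : ℕ → ℕ → ℕ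
    cell x y = sumℕ R (λ s → covers y (x ℕ.* R ℕ.+ s))

    window : ∀ y c → sumℕ n (λ s → covers y (c ℕ.+ s)) ≡ 1
    window y zero    = trans (sumℕ-cong n (λ s s<n → trans (cong (λ v → hit v (y % n)) (m<n⇒m%n≡m s<n)) (hit-sym s (y % n))))
                             (hit-once n (y % n) (m%n<n y n))
    window y (suc c) = trans (sumℕ-rotate n (covers y) c (cong (λ v → hit v (y % n)) ([m+n]%n≡m%n c n))) (window y c)

    cell-binary : ∀ x y → cell x y ≡ 0 ⊎ cell x y ≡ 1
    cell-binary x y with cell x y
                       | subst (cell x y ℕ.≤_) (window y (x ℕ.* R)) (sumℕ-mono (λ s → covers y (x ℕ.* R ℕ.+ s)) R≤n)
    ... | 0 | _ = inj₁ refl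
    ... | 1 | _ = inj₂ refl
    ... | suc (suc _) | s≤s ()

    rowSum : ∀ x → sumℕ n (cell x) ≡ R
    rowSum x = begin
      sumℕ n (λ y → sumℕ R (λ s → covers y (x ℕ.* R ℕ.+ s)))  ≡⟨ sumℕ-comm n R (λ y s → covers y (x ℕ.* R ℕ.+ s)) ⟩
      sumℕ R (λ s → sumℕ n (λ y → covers y (x ℕ.* R ℕ.+ s)))  ≡⟨ sumℕ-cong R (λ s _ → trans
        (sumℕ-cong n (λ y y<n → cong (hit ((x ℕ.* R ℕ.+ s) % n)) (m<n⇒m%n≡m y<n)))
        (hit-once n _ (m%n<n (x ℕ.* R ℕ.+ s) n))) ⟩
      sumℕ R (λ _ → 1)                                         ≡⟨ trans (sumℕ-const R 1) (ℕP.*-identityʳ R) ⟩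
      R ∎
      where open ≡-Reasoning

    colSum : ∀ y → sumℕ m (λ x → cell x y) ≡ C
    colSum y = begin
      sumℕ m (λ x → cell x y)                 ≡⟨ sym (sumℕ-blocks m R (covers y)) ⟩
      sumℕ (m ℕ.* R) (covers y)               ≡⟨ cong (λ k → sumℕ k (covers y)) (trans mR≡nC (ℕP.*-comm n C)) ⟩
      sumℕ (C ℕ.* n) (covers y)               ≡⟨ sumℕ-blocks C n (covers y) ⟩
      sumℕ C (λ u → sumℕ n (λ s → covers y (u ℕ.* n ℕ.+ s))) ≡⟨ sumℕ-cong C (λ u _ → trans
        (sumℕ-cong n (λ s _ → cong (λ v → hit v (y % n)) (trans (cong (_% n) (ℕP.+-comm (u ℕ.* n) s)) ([m+kn]%n≡m%n s u n))))
        (window y 0)) ⟩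
      sumℕ C (λ _ → 1)                        ≡⟨ trans (sumℕ-const C 1) (ℕP.*-identityʳ C) ⟩
      C ∎
      where open ≡-Reasoning

  ∑<-pos : ∀ n g → ∑< n (λ t → + g t) ≡ + sumℕ n g
  ∑<-pos zero    g = refl
  ∑<-pos (suc n) g = trans (cong (_+_ (+ g 0)) (∑<-pos n (λ t → g (suc t)))) (sym (ℤP.pos-+ (g 0) _))

  record RegularMatrix (m n R C : ℕ) : Set where
    field
      entry  : ℕ → ℕ → ℤ
      binary : ∀ x y → Binary (entry x y)
      rowSum : ∀ x → ∑< n (entry x) ≡ + R
      colSum : ∀ y → ∑< m (λ x → entry x y) ≡ + C

  regular-matrix : ∀ m n R C .{{_ : NonZero n}} → m ℕ.* R ≡ n ℕ.* C → R ℕ.≤ n → RegularMatrix m n R C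
  regular-matrix m n R C mR≡nC R≤n = record
    { entry  = λ x y → + cell x y
    ; binary = λ x y → Data.Sum.map (cong (λ v → + v)) (cong (λ v → + v)) (cell-binary x y)
    ; rowSum = λ x → trans (∑<-pos n (cell x)) (cong (λ v → + v) (rowSum x))
    ; colSum = λ y → trans (∑<-pos m (λ x → cell x y)) (cong (λ v → + v) (colSum y)) }
    where open Cyclic m n R C mR≡nC R≤n

  -- A zero block of E is filled by Z on its two diagonal sub-blocks and by 1 - Z on the other two.
  twist : ℤ → ℤ → ℤ
  twist -[1+ _ ] z = + 1 - z
  twist (+ _)    z = z

  fill : Blk → Blk → ℤ → ℤ
  fill r c z = fixedPart (sign r c) + freeMask (sign r c) * twist (side r * side c) z

  fill-binary : ∀ r c {z} → Binary z → Binary (fill r c z) × Binary (fill r c z + sign r c)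
  fill-binary r c (inj₁ refl) = from-yes (∀ᴮ? λ r → ∀ᴮ? λ c →
    binary? (fill r c (+ 0)) ×-dec binary? (fill r c (+ 0) + sign r c)) r c
  fill-binary r c (inj₂ refl) = from-yes (∀ᴮ? λ r → ∀ᴮ? λ c →
    binary? (fill r c (+ 1)) ×-dec binary? (fill r c (+ 1) + sign r c)) r c

  freeWeight-fill : ∀ r c z → freeWeight r c * fill r c z ≡ freeWeight r c * twist (side r * side c) z
  freeWeight-fill r c z with sign r c | sign-values r c
  ... | _ | inj₁ refl        = refl
  ... | _ | inj₂ (inj₂ refl) = refl
  ... | _ | inj₂ (inj₁ refl) = cong (λ x → + 1 * side c * x) (trans (ℤP.+-identityˡ _) (ℤP.*-identityˡ _))

  freeWeight-pairWeight : ∀ r c → freeWeight r c ≡ pairWeight (partner (pairOf r)) c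
  freeWeight-pairWeight = from-yes (∀ᴮ? λ r → ∀ᴮ? λ c → freeWeight r c ℤ.≟ pairWeight (partner (pairOf r)) c)

  ∑<-complement : ∀ n (h : ℕ → ℤ) → ∑< n (λ y → + 1 - h y) ≡ + n - ∑< n h
  ∑<-complement n h = trans (∑-distrib-+ {n} (λ _ → + 1) _)
    (cong₂ _+_ (trans (∑-const n (+ 1)) (ℤP.*-identityʳ (+ n))) (∑-neg {n} (λ t → h (toℕ t))))

  twisted-difference : ∀ {σ} → σ ≡ pos ⊎ σ ≡ neg → ∀ N₁ N₂ (g : ℕ → ℤ) R → ∑< (N₁ ℕ.+ N₂) g ≡ + R →
    + 2 * (∑< N₁ (λ y → twist σ (g y)) - ∑< N₂ (λ y → twist (- σ) (g (N₁ ℕ.+ y))))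
      ≡ σ * (+ 2 * + R - (+ N₁ + + N₂)) + (+ N₁ - + N₂)
  twisted-difference {σ} σ±1 N₁ N₂ g R total = begin
    + 2 * (∑< N₁ (λ y → twist σ (g y)) - ∑< N₂ (λ y → twist (- σ) (h y)))  ≡⟨ by-sign σ±1 ⟩
    σ * (+ 2 * (S₁ + S₂) - (+ N₁ + + N₂)) + (+ N₁ - + N₂)
      ≡⟨ cong (λ x → σ * (+ 2 * x - (+ N₁ + + N₂)) + (+ N₁ - + N₂)) (trans (sym (∑<-+ N₁ N₂ g)) total) ⟩
    σ * (+ 2 * + R - (+ N₁ + + N₂)) + (+ N₁ - + N₂) ∎
    where
    open ≡-Reasoning
    h : ℕ → ℤ
    h y = g (N₁ ℕ.+ y)
    S₁ = ∑< N₁ g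
    S₂ = ∑< N₂ h
    by-sign : σ ≡ pos ⊎ σ ≡ neg → + 2 * (∑< N₁ (λ y → twist σ (g y)) - ∑< N₂ (λ y → twist (- σ) (h y)))
                                 ≡ σ * (+ 2 * (S₁ + S₂) - (+ N₁ + + N₂)) + (+ N₁ - + N₂)
    by-sign (inj₁ refl) = trans (cong (λ x → + 2 * (S₁ - x)) (∑<-complement N₂ h)) (expand S₁ S₂ (+ N₁) (+ N₂))
      where
      expand : ∀ s₁ s₂ n₁ n₂ → + 2 * (s₁ - (n₂ - s₂)) ≡ pos * (+ 2 * (s₁ + s₂) - (n₁ + n₂)) + (n₁ - n₂)
      expand = solve-∀
    by-sign (inj₂ refl) = trans (cong (λ x → + 2 * (x - S₂)) (∑<-complement N₁ g)) (expand S₁ S₂ (+ N₁) (+ N₂))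
      where
      expand : ∀ s₁ s₂ n₁ n₂ → + 2 * (n₁ - s₁ - s₂) ≡ neg * (+ 2 * (s₁ + s₂) - (n₁ + n₂)) + (n₁ - n₂)
      expand = solve-∀

  side-values : ∀ r → side r ≡ pos ⊎ side r ≡ neg
  side-values = tabulateᴮ (inj₁ refl) (inj₂ refl) (inj₁ refl) (inj₂ refl) (inj₁ refl) (inj₂ refl)

  module Build (x₁ x₂ x₃ x₄ x₅ x₆ y₁ y₂ y₃ y₄ y₅ y₆ : ℕ) (Z : Pair → ℕ → ℕ → ℤ) where

    module R = Blocks x₁ x₂ x₃ x₄ x₅ x₆
    module C = Blocks y₁ y₂ y₃ y₄ y₅ y₆

    build : Matrix R.Size C.Size
    build i j = fill (R.bl i) (C.bl j) (Z (pairOf (R.bl i)) (R.positionInPair i) (C.positionInPair j))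

    module _ (Z-binary : ∀ t x y → Binary (Z t x y)) where

      build-binary : IsBinary build
      build-binary i j = proj₁ (fill-binary (R.bl i) (C.bl j) (Z-binary _ _ _))

      build-sign-binary : IsBinary (build ⊕ λ i j → sign (R.bl i) (C.bl j))
      build-sign-binary i j = proj₂ (fill-binary (R.bl i) (C.bl j) (Z-binary _ _ _))

    first-of-pair : ∀ u → side (first u) ≡ pos × C.offsetInPair (first u) ≡ 0
    first-of-pair π₁ = refl , refl
    first-of-pair π₂ = refl , refl
    first-of-pair π₃ = refl , refl

    second-of-pair : ∀ u → side (second u) ≡ neg × C.offsetInPair (second u) ≡ C.size (first u)
    second-of-pair π₁ = refl , refl
    second-of-pair π₂ = refl , refl
    second-of-pair π₃ = refl , refl

    twisted-row : ∀ i → let t = pairOf (R.bl i); N₁ = C.size (first (partner t)); x = R.positionInPair i in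
      ∑ (λ j → freeWeight (R.bl i) (C.bl j) * build i j)
        ≡ ∑< N₁ (λ y → twist (side (R.bl i)) (Z t x y))
          - ∑< (C.size (second (partner t))) (λ y → twist (- side (R.bl i)) (Z t x (N₁ ℕ.+ y)))
    twisted-row i = begin
      ∑ (λ j → freeWeight r (C.bl j) * build i j)
        ≡⟨ ∑-cong (λ j → freeWeight-fill r (C.bl j) _) ⟩
      ∑ (λ j → freeWeight r (C.bl j) * twist (side r * side (C.bl j)) (Z t x (C.positionInPair j)))
        ≡⟨ C.∑-byBlock (λ c y → freeWeight r c * twist (side r * side c) (Z t x (C.offsetInPair c ℕ.+ y))) ⟩
      Σᴮ (λ c → ∑< (C.size c) (λ y → freeWeight r c * twist (side r * side c) (Z t x (C.offsetInPair c ℕ.+ y))))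
        ≡⟨ Σᴮ-cong (λ c → trans (sym (*-distribˡ-∑ {C.size c} (freeWeight r c) _))
                                (cong (_* S c) (freeWeight-pairWeight r c))) ⟩
      Σᴮ (λ c → pairWeight u c * S c)
        ≡⟨ Σᴮ-pairWeight u S ⟩
      S (first u) - S (second u)
        ≡⟨ cong₂ _-_ first-block second-block ⟩
      ∑< N₁ (λ y → twist (side r) (Z t x y)) - ∑< N₂ (λ y → twist (- side r) (Z t x (N₁ ℕ.+ y))) ∎
      where
      open ≡-Reasoning
      r = R.bl i
      t = pairOf r
      u = partner t
      x = R.positionInPair i
      N₁ = C.size (first u)
      N₂ = C.size (second u)
      S : Blk → ℤ
      S c = ∑< (C.size c) (λ y → twist (side r * side c) (Z t x (C.offsetInPair c ℕ.+ y)))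
      first-block : S (first u) ≡ ∑< N₁ (λ y → twist (side r) (Z t x y))
      first-block = ∑<-cong N₁ (λ y _ → cong₂ (λ σ p → twist σ (Z t x (p ℕ.+ y)))
        (trans (cong (side r *_) (proj₁ (first-of-pair u))) (ℤP.*-identityʳ (side r))) (proj₂ (first-of-pair u)))
      second-block : S (second u) ≡ ∑< N₂ (λ y → twist (- side r) (Z t x (N₁ ℕ.+ y)))
      second-block = ∑<-cong N₂ (λ y _ → cong₂ (λ σ p → twist σ (Z t x (p ℕ.+ y)))
        (trans (cong (side r *_) (proj₁ (second-of-pair u))) (trans (ℤP.*-comm (side r) neg) (ℤP.-1*i≡-i (side r))))
        (proj₂ (second-of-pair u)))

    twice-freeSum : (ρ : Pair → ℕ) →
      (∀ t x → ∑< (C.size (first (partner t)) ℕ.+ C.size (second (partner t))) (Z t x) ≡ + ρ t) →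
      ∀ i → let t = pairOf (R.bl i); N₁ = C.size (first (partner t)); N₂ = C.size (second (partner t)) in
      + 2 * ∑ (λ j → freeWeight (R.bl i) (C.bl j) * build i j)
        ≡ side (R.bl i) * (+ 2 * + ρ t - (+ N₁ + + N₂)) + (+ N₁ - + N₂)
    twice-freeSum ρ rowSum i = trans (cong (+ 2 *_) (twisted-row i))
      (twisted-difference (side-values (R.bl i)) (C.size (first (partner t))) (C.size (second (partner t)))
                          (Z t (R.positionInPair i)) (ρ t) (rowSum t (R.positionInPair i)))
      where t = pairOf (R.bl i)

  free-or-partner : ∀ r c → freeMask (sign r c) ≡ + 0 ⊎ pairOf r ≡ partner (pairOf c)
  free-or-partner = from-yes (∀ᴮ? λ r → ∀ᴮ? λ c →
    (freeMask (sign r c) ℤ.≟ + 0) ⊎-dec (pairOf r ≟ᴾ partner (pairOf c)))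

  fill-transpose : ∀ r c (F : Pair → ℤ) → fill r c (F (pairOf r)) ≡ fill c r (F (partner (pairOf c)))
  fill-transpose r c F = trans (cong (_+_ (fixedPart (sign r c))) masked)
    (cong₂ (λ s σ → fixedPart s + freeMask s * twist σ (F (partner (pairOf c))))
           (sign-symmetric r c) (ℤP.*-comm (side r) (side c)))
    where
    masked : freeMask (sign r c) * twist (side r * side c) (F (pairOf r))
           ≡ freeMask (sign r c) * twist (side r * side c) (F (partner (pairOf c)))
    masked with freeMask (sign r c) | free-or-partner r c
    ... | _ | inj₁ refl = refl
    ... | μ | inj₂ eq   = cong (λ t → μ * twist (side r * side c) (F t)) eq

  module _ (x₁ x₂ x₃ x₄ x₅ x₆ y₁ y₂ y₃ y₄ y₅ y₆ : ℕ) (Z : Pair → ℕ → ℕ → ℤ) where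
    private
      module B  = Build x₁ x₂ x₃ x₄ x₅ x₆ y₁ y₂ y₃ y₄ y₅ y₆ Z
      module Bᵀ = Build y₁ y₂ y₃ y₄ y₅ y₆ x₁ x₂ x₃ x₄ x₅ x₆ (λ t x y → Z (partner t) y x)

    build-transpose : transpose B.build ≐ Bᵀ.build
    build-transpose j i = fill-transpose (B.R.bl i) (B.C.bl j) (λ t → Z t (B.R.positionInPair i) (B.C.positionInPair j))

  sign-nonzero : ∀ r c → pairOf r ≡ π₁ → pairOf c ≡ π₁ → sign r c ≢ + 0
  sign-nonzero = from-yes (∀ᴮ? λ r → ∀ᴮ? λ c →
    (pairOf r ≟ᴾ π₁) →-dec (pairOf c ≟ᴾ π₁) →-dec ¬? (sign r c ℤ.≟ + 0))

  slope-side : ∀ r → side r * pairSlope (pairOf r) ≡ slope r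
  slope-side = from-yes (∀ᴮ? λ r → side r * pairSlope (pairOf r) ℤ.≟ slope r)

  target-from-half : ∀ x {Λ ρ N δ α} → + 2 * + ρ ≡ pairSlope (pairOf x) * Λ + N → δ ≡ offset x * α →
                     side x * (+ 2 * + ρ - N) + δ ≡ target x α Λ
  target-from-half x {Λ} {ρ} {N} {δ} {α} half δ≡ = begin
    side x * (+ 2 * + ρ - N) + δ                      ≡⟨ cong (λ h → side x * (h - N) + δ) half ⟩
    side x * (pairSlope (pairOf x) * Λ + N - N) + δ   ≡⟨ cong₂ (λ h d → side x * h + d) (plus-minus _ N) δ≡ ⟩
    side x * (pairSlope (pairOf x) * Λ) + offset x * α ≡⟨ cong (_+ offset x * α) (sym (ℤP.*-assoc (side x) _ Λ)) ⟩
    side x * pairSlope (pairOf x) * Λ + offset x * α   ≡⟨ cong (λ σ → σ * Λ + offset x * α) (slope-side x) ⟩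
    slope x * Λ + offset x * α ∎
    where
    open ≡-Reasoning
    plus-minus : ∀ y z → y + z - z ≡ y
    plus-minus = solve-∀

  -- Choosing the parameters

  2∣n+n : ∀ n → 2 ∣ n ℕ.+ n
  2∣n+n n = divides n (trans (cong (n ℕ.+_) (sym (ℕP.+-identityʳ n))) (ℕP.*-comm 2 n))

  even-combine : ∀ {x y z} → 2 ∣ x ℕ.+ y → 2 ∣ x ℕ.+ z → 2 ∣ y ℕ.+ z
  even-combine {x} {y} {z} x+y x+z = ∣m+n∣m⇒∣n (subst (2 ∣_) (regroup x y z) (∣m∣n⇒∣m+n x+y x+z)) (2∣n+n x)
    where
    regroup : ∀ x y z → x ℕ.+ y ℕ.+ (x ℕ.+ z) ≡ x ℕ.+ x ℕ.+ (y ℕ.+ z)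
    regroup = ℕ-solve-∀

  half-shift : ∀ {σ} → σ ≡ pos ⊎ σ ≡ neg → ∀ u N₁ N₂ → u ℕ.≤ N₁ ℕ.+ N₂ → 2 ∣ u ℕ.+ (N₁ ℕ.+ N₂) →
               Σ ℕ λ h → + 2 * + h ≡ σ * + u + (+ N₁ + + N₂) × h ℕ.≤ N₁ ℕ.+ N₂
  half-shift (inj₁ refl) u N₁ N₂ u≤N (divides h u+N≡h*2) = h , doubled , bound
    where
    N = N₁ ℕ.+ N₂
    doubled : + 2 * + h ≡ pos * + u + (+ N₁ + + N₂)
    doubled = begin
      + 2 * + h               ≡⟨ sym (ℤP.pos-* 2 h) ⟩
      + (2 ℕ.* h)             ≡⟨ cong +_ (trans (ℕP.*-comm 2 h) (sym u+N≡h*2)) ⟩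
      + (u ℕ.+ N)             ≡⟨ trans (ℤP.pos-+ u N) (cong (_+_ (+ u)) (ℤP.pos-+ N₁ N₂)) ⟩
      + u + (+ N₁ + + N₂)     ≡⟨ cong (_+ (+ N₁ + + N₂)) (sym (ℤP.*-identityˡ (+ u))) ⟩
      pos * + u + (+ N₁ + + N₂) ∎
      where open ≡-Reasoning
    bound : h ℕ.≤ N
    bound = ℕP.*-cancelʳ-≤ h N 2 (subst (ℕ._≤ N ℕ.* 2) u+N≡h*2
              (subst (u ℕ.+ N ℕ.≤_) (trans (cong (N ℕ.+_) (sym (ℕP.+-identityʳ N))) (ℕP.*-comm 2 N))
                (ℕP.+-monoˡ-≤ N u≤N)))
  half-shift (inj₂ refl) u N₁ N₂ u≤N u+N-even with ∣m+n∣m⇒∣n (subst (2 ∣_) split u+N-even) (2∣n+n u)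
    where
    split : u ℕ.+ (N₁ ℕ.+ N₂) ≡ u ℕ.+ u ℕ.+ (N₁ ℕ.+ N₂ ℕ.∸ u)
    split = trans (cong (u ℕ.+_) (sym (ℕP.m+[n∸m]≡n u≤N))) (sym (ℕP.+-assoc u u _))
  ... | divides h D≡h*2 = h , doubled , bound
    where
    N = N₁ ℕ.+ N₂
    D = N ℕ.∸ u
    doubled : + 2 * + h ≡ neg * + u + (+ N₁ + + N₂)
    doubled = begin
      + 2 * + h               ≡⟨ sym (ℤP.pos-* 2 h) ⟩
      + (2 ℕ.* h)             ≡⟨ cong +_ (trans (ℕP.*-comm 2 h) (sym D≡h*2)) ⟩
      + D                     ≡⟨ solve-for-D (+ u) (+ D) ⟩
      - + u + (+ u + + D)     ≡⟨ cong (λ x → - + u + x) (trans (sym (ℤP.pos-+ u D)) (cong +_ (ℕP.m+[n∸m]≡n u≤N))) ⟩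
      - + u + + N             ≡⟨ cong₂ _+_ (sym (ℤP.-1*i≡-i (+ u))) (ℤP.pos-+ N₁ N₂) ⟩
      neg * + u + (+ N₁ + + N₂) ∎
      where
      open ≡-Reasoning
      solve-for-D : ∀ x y → y ≡ - x + (x + y)
      solve-for-D = solve-∀
    bound : h ℕ.≤ N
    bound = ℕP.≤-trans (ℕP.m≤m*n h 2) (subst (ℕ._≤ N) D≡h*2 (ℕP.m∸n≤m N u))

  minimal-pair : (N : Pair → ℕ) → Σ Pair λ s → ∀ t → N s ℕ.≤ N t
  minimal-pair N with ℕP.≤-total (N π₁) (N π₂)
  ... | inj₁ 1≤2 with ℕP.≤-total (N π₁) (N π₃)
  ...   | inj₁ 1≤3 = π₁ , λ { π₁ → ℕP.≤-refl ; π₂ → 1≤2 ; π₃ → 1≤3 }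
  ...   | inj₂ 3≤1 = π₃ , λ { π₁ → 3≤1 ; π₂ → ℕP.≤-trans 3≤1 1≤2 ; π₃ → ℕP.≤-refl }
  minimal-pair N | inj₂ 2≤1 with ℕP.≤-total (N π₂) (N π₃)
  ...   | inj₁ 2≤3 = π₂ , λ { π₁ → 2≤1 ; π₂ → ℕP.≤-refl ; π₃ → 2≤3 }
  ...   | inj₂ 3≤2 = π₃ , λ { π₁ → ℕP.≤-trans 3≤2 2≤1 ; π₂ → 3≤2 ; π₃ → ℕP.≤-refl }

  factor-bound : ∀ {A B C D} → A ℕ.* B ≡ C ℕ.* D → B ℕ.≤ C → C > 0 → D ℕ.≤ A
  factor-bound {A} {B} {C} {D} eq B≤C C>0 = ℕP.*-cancelˡ-≤ C {{ℕ.>-nonZero C>0}}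
    (subst (ℕ._≤ C ℕ.* A) eq (subst (A ℕ.* B ℕ.≤_) (ℕP.*-comm A C) (ℕP.*-monoʳ-≤ A B≤C)))

  halves-agree : ∀ {M N U V σ ρ κ} → M * U ≡ N * V → + 2 * ρ ≡ σ * U + N → + 2 * κ ≡ σ * V + M → M * ρ ≡ N * κ
  halves-agree {M} {N} {U} {V} {σ} {ρ} {κ} MU≡NV twice-ρ twice-κ = ℤP.*-cancelˡ-≡ (+ 2) _ _ (begin
    + 2 * (M * ρ)        ≡⟨ swap (+ 2) M ρ ⟩
    M * (+ 2 * ρ)        ≡⟨ cong (M *_) twice-ρ ⟩
    M * (σ * U + N)      ≡⟨ expand M N U σ ⟩
    σ * (M * U) + M * N  ≡⟨ cong₂ (λ x y → σ * x + y) MU≡NV (ℤP.*-comm M N) ⟩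
    σ * (N * V) + N * M  ≡⟨ sym (expand N M V σ) ⟩
    N * (σ * V + M)      ≡⟨ cong (N *_) (sym twice-κ) ⟩
    N * (+ 2 * κ)        ≡⟨ sym (swap (+ 2) N κ) ⟩
    + 2 * (N * κ) ∎)
    where
    open ≡-Reasoning
    swap : ∀ x y z → x * (y * z) ≡ y * (x * z)
    swap = solve-∀
    expand : ∀ M N U σ → M * (σ * U + N) ≡ σ * (M * U) + M * N
    expand = solve-∀

  pos-pairSize-* : ∀ (size : Blk → ℕ) t x →
    + ((size (first t) ℕ.+ size (second t)) ℕ.* x) ≡ pairSize (λ b → + size b) t * + x
  pos-pairSize-* size t x = trans (ℤP.pos-* (size (first t) ℕ.+ size (second t)) x)
                                  (cong (_* + x) (ℤP.pos-+ (size (first t)) (size (second t))))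

  same-parity : (P : Pair → ℕ) → 2 ∣ P π₁ ℕ.+ P π₂ → 2 ∣ P π₁ ℕ.+ P π₃ → ∀ t t' → 2 ∣ P t ℕ.+ P t'
  same-parity P 1~2 1~3 = parity
    where
    flip : ∀ x y → 2 ∣ x ℕ.+ y → 2 ∣ y ℕ.+ x
    flip x y = subst (2 ∣_) (ℕP.+-comm x y)
    2~3 : 2 ∣ P π₂ ℕ.+ P π₃
    2~3 = even-combine {P π₁} 1~2 1~3
    parity : ∀ t t' → 2 ∣ P t ℕ.+ P t'
    parity π₁ π₁ = 2∣n+n (P π₁)
    parity π₁ π₂ = 1~2
    parity π₁ π₃ = 1~3
    parity π₂ π₁ = flip (P π₁) (P π₂) 1~2
    parity π₂ π₂ = 2∣n+n (P π₂)
    parity π₂ π₃ = 2~3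
    parity π₃ π₁ = flip (P π₁) (P π₃) 1~3
    parity π₃ π₂ = flip (P π₂) (P π₃) 2~3
    parity π₃ π₃ = 2∣n+n (P π₃)

  proportional-pairs : (M N : Pair → ℕ) → M π₂ > 0 →
    N π₃ ℕ.* M π₂ ≡ N π₂ ℕ.* M π₁ → N π₂ ℕ.* M π₃ ≡ N π₁ ℕ.* M π₂ →
    ∀ t t' → M t ℕ.* N t' ≡ N (partner t) ℕ.* M (partner t')
  proportional-pairs M N M₂>0 r₁ r₂ = proportional
    where
    r₃ : M π₁ ℕ.* N π₁ ≡ N π₃ ℕ.* M π₃
    r₃ = ℕP.*-cancelʳ-≡ _ _ (M π₂) {{ℕ.>-nonZero M₂>0}} (begin
      M π₁ ℕ.* N π₁ ℕ.* M π₂    ≡⟨ regroup (M π₁) (N π₁) (M π₂) ⟩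
      M π₁ ℕ.* (N π₁ ℕ.* M π₂)  ≡⟨ cong (M π₁ ℕ.*_) (sym r₂) ⟩
      M π₁ ℕ.* (N π₂ ℕ.* M π₃)  ≡⟨ regroup′ (M π₁) (N π₂) (M π₃) ⟩
      N π₂ ℕ.* M π₁ ℕ.* M π₃    ≡⟨ cong (ℕ._* M π₃) (sym r₁) ⟩
      N π₃ ℕ.* M π₂ ℕ.* M π₃    ≡⟨ regroup″ (N π₃) (M π₂) (M π₃) ⟩
      N π₃ ℕ.* M π₃ ℕ.* M π₂ ∎)
      where
      open ≡-Reasoning
      regroup : ∀ x y z → x ℕ.* y ℕ.* z ≡ x ℕ.* (y ℕ.* z)
      regroup = ℕ-solve-∀
      regroup′ : ∀ x y z → x ℕ.* (y ℕ.* z) ≡ y ℕ.* x ℕ.* z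
      regroup′ = ℕ-solve-∀
      regroup″ : ∀ x y z → x ℕ.* y ℕ.* z ≡ x ℕ.* z ℕ.* y
      regroup″ = ℕ-solve-∀
    proportional : ∀ t t' → M t ℕ.* N t' ≡ N (partner t) ℕ.* M (partner t')
    proportional π₁ π₁ = r₃
    proportional π₁ π₂ = trans (ℕP.*-comm (M π₁) (N π₂)) (sym r₁)
    proportional π₁ π₃ = ℕP.*-comm (M π₁) (N π₃)
    proportional π₂ π₁ = trans (ℕP.*-comm (M π₂) (N π₁)) (sym r₂)
    proportional π₂ π₂ = ℕP.*-comm (M π₂) (N π₂)
    proportional π₂ π₃ = trans (ℕP.*-comm (M π₂) (N π₃)) r₁
    proportional π₃ π₁ = ℕP.*-comm (M π₃) (N π₁)
    proportional π₃ π₂ = trans (ℕP.*-comm (M π₃) (N π₂)) r₂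
    proportional π₃ π₃ = trans (ℕP.*-comm (M π₃) (N π₃)) (trans (sym r₃) (ℕP.*-comm (M π₁) (N π₁)))

  module Instance (a b c d e f k l p q r s : ℕ)
    (hab : a ℕ.+ b > 0) (hcd : c ℕ.+ d > 0) (hef : e ℕ.+ f > 0)
    (hkl : k ℕ.+ l > 0) (hpq : p ℕ.+ q > 0) (hrs : r ℕ.+ s > 0)
    (rowSums : RowSumsZero (Emat a b c d e f k l p q r s))
    (colSums : ColSumsZero (Emat a b c d e f k l p q r s)) where

    module R = Blocks k l p q r s
    module C = Blocks a b c d e f

    E : Matrix R.Size C.Size
    E = Emat a b c d e f k l p q r s

    m n : Blk → ℤ
    m x = + R.size x
    n x = + C.size x

    Eᵀ-sign : ∀ j i → transpose E j i ≡ sign (C.bl j) (R.bl i)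
    Eᵀ-sign j i = sign-symmetric (R.bl i) (C.bl j)

    rowSum : ∀ i → Σᴮ (λ x → n x * sign (R.bl i) x) ≡ + 0
    rowSum i = trans (sym (C.∑-count (sign (R.bl i)))) (rowSums i)

    colSum : ∀ j → Σᴮ (λ x → m x * sign (C.bl j) x) ≡ + 0
    colSum j = trans (sym (R.∑-count (sign (C.bl j)))) (trans (∑-cong (λ i → sym (Eᵀ-sign j i))) (colSums j))

    n-balance₂ : n b₁ - n b₂ + (n b₃ - n b₄) ≡ + 0
    n-balance₂ = let (i , i∈π₁) = R.inPair π₁ hkl in signedSum₂ (R.bl i) n i∈π₁ (rowSum i)
    n-balance₃ : n b₁ - n b₂ + (n b₅ - n b₆) ≡ + 0
    n-balance₃ = let (i , i∈π₂) = R.inPair π₂ hpq in signedSum₃ (R.bl i) n i∈π₂ (rowSum i)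
    m-balance₂ : m b₁ - m b₂ + (m b₃ - m b₄) ≡ + 0
    m-balance₂ = let (j , j∈π₁) = C.inPair π₁ hab in signedSum₂ (C.bl j) m j∈π₁ (colSum j)
    m-balance₃ : m b₁ - m b₂ + (m b₅ - m b₆) ≡ + 0
    m-balance₃ = let (j , j∈π₂) = C.inPair π₂ hcd in signedSum₃ (C.bl j) m j∈π₂ (colSum j)

    module Rows = GramRows R.bl C.bl n C.∑-count n-balance₂ n-balance₃ E (λ _ _ → refl)
    module Cols = GramRows C.bl R.bl m R.∑-count m-balance₂ m-balance₃ (transpose E) Eᵀ-sign

    record Parameters : Set where
      field
        Λ Λ' : ℤ
        proportional : ∀ t → pairSize m t * Λ ≡ pairSize n (partner t) * Λ'
        Λ-parity  : Σ ℤ λ w → Λ ≡ Rows.α + + 2 * w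
        Λ'-parity : Σ ℤ λ w → Λ' ≡ Cols.α + + 2 * w

    offsets-agree : ∀ t → pairOffset t * (pairDiff m t * Rows.α) ≡ pairOffset (partner t) * (pairDiff n (partner t) * Cols.α)
    offsets-agree t = begin
      pairOffset t * (pairDiff m t * Rows.α)
        ≡⟨ cong (λ d → pairOffset t * (d * Rows.α)) m-diff ⟩
      pairOffset t * (pairOffset (partner t) * Cols.α * Rows.α)
        ≡⟨ exchange (pairOffset t) (pairOffset (partner t)) Cols.α Rows.α ⟩
      pairOffset (partner t) * (pairOffset t * Rows.α * Cols.α)
        ≡⟨ cong (λ d → pairOffset (partner t) * (d * Cols.α)) (sym n-diff) ⟩
      pairOffset (partner t) * (pairDiff n (partner t) * Cols.α) ∎
      where
      open ≡-Reasoning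
      m-diff : pairDiff m t ≡ pairOffset (partner t) * Cols.α
      m-diff = trans (cong (pairDiff m) (sym (trans (cong partner (pairOf-first (partner t))) (partner-involutive t))))
                     (offset-balance m m-balance₂ m-balance₃ (first (partner t)))
      n-diff : pairDiff n (partner t) ≡ pairOffset t * Rows.α
      n-diff = trans (cong (λ u → pairDiff n (partner u)) (sym (pairOf-first t)))
                     (offset-balance n n-balance₂ n-balance₃ (first t))
      exchange : ∀ o o′ x y → o * (o′ * x * y) ≡ o′ * (o * y * x)
      exchange = solve-∀

    double-count : ∀ A t → ∑ (λ i → pairWeight t (R.bl i) * Rows.freeSum A i)
                         ≡ ∑ (λ j → pairWeight (partner t) (C.bl j) * Cols.freeSum (transpose A) j)
    double-count A t = begin
      ∑ (λ i → wr (R.bl i) * Rows.freeSum A i)                 ≡⟨ Rows.∑-weighted A wr wc (pairWeight-compatible t) ⟩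
      ∑ (λ i → ∑ (λ j → wr (R.bl i) * wc (C.bl j) * A i j))    ≡⟨ ∑-comm (λ i j → wr (R.bl i) * wc (C.bl j) * A i j) ⟩
      ∑ (λ j → ∑ (λ i → wr (R.bl i) * wc (C.bl j) * A i j))    ≡⟨ ∑-cong (λ j → ∑-cong (λ i →
                                                                    cong (_* A i j) (ℤP.*-comm (wr (R.bl i)) (wc (C.bl j))))) ⟩
      ∑ (λ j → ∑ (λ i → wc (C.bl j) * wr (R.bl i) * A i j))    ≡⟨ sym (Cols.∑-weighted (transpose A) wc wr compatible) ⟩
      ∑ (λ j → wc (C.bl j) * Cols.freeSum (transpose A) j) ∎
      where
      open ≡-Reasoning
      wr = pairWeight t
      wc = pairWeight (partner t)
      compatible : ∀ x y → wc x * freeWeight x y ≡ wc x * wr y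
      compatible x y = trans (pairWeight-compatible (partner t) x y)
                             (cong (λ t' → wc x * pairWeight t' y) (partner-involutive t))

    proportional-parameters : ∀ A Λ Λ' → (∀ i → + 2 * Rows.freeSum A i ≡ target (R.bl i) Rows.α Λ) →
      (∀ j → + 2 * Cols.freeSum (transpose A) j ≡ target (C.bl j) Cols.α Λ') →
      ∀ t → pairSize m t * Λ ≡ pairSize n (partner t) * Λ'
    proportional-parameters A Λ Λ' on-row on-col t =
      ℤP.*-cancelˡ-≡ (pairSlope t) _ _ {{ℤ.≢-nonZero (pairSlope≢0 t)}} (+-cancelʳ _ _ _ (begin
        pairSlope t * (pairSize m t * Λ) + pairOffset t * (pairDiff m t * Rows.α)
          ≡⟨ sym (doubled-weighted-sum R.bl m R.∑-count (Rows.freeSum A) Rows.α Λ on-row t) ⟩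
        + 2 * ∑ (λ i → pairWeight t (R.bl i) * Rows.freeSum A i)
          ≡⟨ cong (+ 2 *_) (double-count A t) ⟩
        + 2 * ∑ (λ j → pairWeight (partner t) (C.bl j) * Cols.freeSum (transpose A) j)
          ≡⟨ doubled-weighted-sum C.bl n C.∑-count (Cols.freeSum (transpose A)) Cols.α Λ' on-col (partner t) ⟩
        pairSlope (partner t) * (pairSize n (partner t) * Λ') + pairOffset (partner t) * (pairDiff n (partner t) * Cols.α)
          ≡⟨ cong₂ (λ σ o → σ * (pairSize n (partner t) * Λ') + o) (pairSlope-partner t) (sym (offsets-agree t)) ⟩
        pairSlope t * (pairSize n (partner t) * Λ') + pairOffset t * (pairDiff m t * Rows.α) ∎))
      where
      open ≡-Reasoning
      pairSlope≢0 : ∀ t → pairSlope t ≢ + 0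
      pairSlope≢0 π₁ ()
      pairSlope≢0 π₂ ()
      pairSlope≢0 π₃ ()

    necessary : Realizable E → Parameters
    necessary (A , A-bin , B-bin , _ , _ , rowGram , colGram , _) = record
      { Λ = Λ ; Λ' = Λ' ; proportional = proportional-parameters A Λ Λ' on-row on-col
      ; Λ-parity = parameter-parity (R.bl i₁) Rows.α (Rows.freeSum A i₁) i₁∈π₁
      ; Λ'-parity = parameter-parity (C.bl j₁) Cols.α (Cols.freeSum Aᵀ j₁) j₁∈π₁ }
      where
      Aᵀ : Matrix C.Size R.Size
      Aᵀ = transpose A
      i₁ = proj₁ (R.inPair π₁ hkl)
      i₁∈π₁ = proj₂ (R.inPair π₁ hkl)
      j₁ = proj₁ (C.inPair π₁ hab)
      j₁∈π₁ = proj₂ (C.inPair π₁ hab)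
      Λ = Rows.parameter (R.bl i₁) (Rows.freeSum A i₁)
      Λ' = Cols.parameter (C.bl j₁) (Cols.freeSum Aᵀ j₁)
      outside : ∀ {x} → x ≡ π₃ → x ≢ π₁
      outside refl ()
      on-row : ∀ i → + 2 * Rows.freeSum A i ≡ target (R.bl i) Rows.α Λ
      on-row = Rows.gram-necessary A (Rows.forced A A-bin B-bin) rowGram
                 i₁ (proj₁ (R.inPair π₃ hrs)) i₁∈π₁ (outside (proj₂ (R.inPair π₃ hrs)))
      on-col : ∀ j → + 2 * Cols.freeSum Aᵀ j ≡ target (C.bl j) Cols.α Λ'
      on-col = Cols.gram-necessary Aᵀ (Cols.forced Aᵀ (λ j i → A-bin i j) (λ j i → B-bin i j)) colGram
                 j₁ (proj₁ (C.inPair π₃ hef)) j₁∈π₁ (outside (proj₂ (C.inPair π₃ hef)))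

    conditions : Parameters → Condition a b c d e f k l p q r s
    conditions P = by-parity (2 ∣? (a ℕ.+ b)) (2 ∣? (k ℕ.+ l))
      where
      open Parameters P
      ab~cd = pairs-same-parity a b c d n-balance₂
      ab~ef = pairs-same-parity a b e f n-balance₃
      kl~pq = pairs-same-parity k l p q m-balance₂
      kl~rs = pairs-same-parity k l r s m-balance₃
      pair≢0 : ∀ x y → x ℕ.+ y > 0 → + x + + y ≢ + 0
      pair≢0 x y pos eq = ℕP.<⇒≢ pos (sym (ℤP.+-injective (trans (ℤP.pos-+ x y) eq)))
      ratios : Λ' ≢ + 0 → ((e ℕ.+ f) ℕ.* (p ℕ.+ q) ≡ (c ℕ.+ d) ℕ.* (k ℕ.+ l))
                        × ((c ℕ.+ d) ℕ.* (r ℕ.+ s) ≡ (a ℕ.+ b) ℕ.* (p ℕ.+ q))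
      ratios Λ'≢0 =
        ℤP.+-injective (trans (sym (pos-pairs e f p q))
          (trans (cross-multiply {+ k + + l} {+ e + + f} {+ p + + q} {+ c + + d} (proportional π₁) (proportional π₂) Λ'≢0)
                 (pos-pairs c d k l))) ,
        ℤP.+-injective (trans (sym (pos-pairs c d r s))
          (trans (cross-multiply {+ p + + q} {+ c + + d} {+ r + + s} {+ a + + b} (proportional π₂) (proportional π₃) Λ'≢0)
                 (pos-pairs a b p q)))
      by-parity : Dec (2 ∣ a ℕ.+ b) → Dec (2 ∣ k ℕ.+ l) → Condition a b c d e f k l p q r s
      by-parity (yes 2∣ab) (yes 2∣kl) = inj₁ (2∣ab , ∣m+n∣m⇒∣n ab~cd 2∣ab , ∣m+n∣m⇒∣n ab~ef 2∣ab ,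
                                        2∣kl , ∣m+n∣m⇒∣n kl~pq 2∣kl , ∣m+n∣m⇒∣n kl~rs 2∣kl)
      by-parity (no 2∤ab)  _          = inj₂ (inj₁ (2∤ab , (λ 2∣cd → 2∤ab (∣m+n∣n⇒∣m ab~cd 2∣cd))
                                           , (λ 2∣ef → 2∤ab (∣m+n∣n⇒∣m ab~ef 2∣ef)))
                               , ratios (nonzero-transfer {+ k + + l} {+ e + + f} (proportional π₁) (pair≢0 k l hkl)
                                           (odd-parameter-nonzero a b Λ _ (proj₂ Λ-parity) 2∤ab)))
      by-parity (yes _)    (no 2∤kl)  = inj₂ (inj₂ (2∤kl , (λ 2∣pq → 2∤kl (∣m+n∣n⇒∣m kl~pq 2∣pq))
                                               , (λ 2∣rs → 2∤kl (∣m+n∣n⇒∣m kl~rs 2∣rs)))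
                                   , ratios (odd-parameter-nonzero k l Λ' _ (proj₂ Λ'-parity) 2∤kl))



    rowPair colPair : Pair → ℕ
    rowPair t = R.size (first t) ℕ.+ R.size (second t)
    colPair t = C.size (first t) ℕ.+ C.size (second t)

    record Design : Set where
      field
        Λ Λ' : ℤ
        ρ κ : Pair → ℕ
        ρ-half : ∀ t → + 2 * + ρ t ≡ pairSlope t * Λ + pairSize n (partner t)
        κ-half : ∀ t → + 2 * + κ t ≡ pairSlope t * Λ' + pairSize m (partner t)
        counts-agree : ∀ t → rowPair t ℕ.* ρ t ≡ colPair (partner t) ℕ.* κ (partner t)
        ρ-bound : ∀ t → ρ t ℕ.≤ colPair (partner t)

    colPair-positive : ∀ t → colPair t > 0
    colPair-positive π₁ = hab
    colPair-positive π₂ = hcd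
    colPair-positive π₃ = hef

    module Filling (D : Design) where
      open Design D

      region : ∀ t → RegularMatrix (rowPair t) (colPair (partner t)) (ρ t) (κ (partner t))
      region t = regular-matrix (rowPair t) (colPair (partner t)) (ρ t) (κ (partner t))
                   {{ℕ.>-nonZero (colPair-positive (partner t))}} (counts-agree t) (ρ-bound t)

      Z : Pair → ℕ → ℕ → ℤ
      Z t = RegularMatrix.entry (region t)

      module B  = Build k l p q r s a b c d e f Z
      module Bᵀ = Build a b c d e f k l p q r s (λ t x y → Z (partner t) y x)

      A : Matrix R.Size C.Size
      A = B.build

      A-binary : IsBinary A
      A-binary = B.build-binary (λ t → RegularMatrix.binary (region t))

      B-binary : IsBinary (A ⊕ E)
      B-binary = B.build-sign-binary (λ t → RegularMatrix.binary (region t))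

      on-row : ∀ i → + 2 * Rows.freeSum A i ≡ target (R.bl i) Rows.α Λ
      on-row i = trans (B.twice-freeSum ρ (λ t → RegularMatrix.rowSum (region t)) i)
        (target-from-half (R.bl i) {ρ = ρ (pairOf (R.bl i))} (ρ-half (pairOf (R.bl i)))
                          (offset-balance n n-balance₂ n-balance₃ (R.bl i)))

      on-col : ∀ j → + 2 * Cols.freeSum (transpose A) j ≡ target (C.bl j) Cols.α Λ'
      on-col j = trans (cong (+ 2 *_) (∑-cong (λ i → cong (freeWeight (C.bl j) (R.bl i) *_)
                                                (build-transpose k l p q r s a b c d e f Z j i))))
        (trans (Bᵀ.twice-freeSum κ transposed-rowSum j)
               (target-from-half (C.bl j) {ρ = κ (pairOf (C.bl j))} (κ-half (pairOf (C.bl j)))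
                                 (offset-balance m m-balance₂ m-balance₃ (C.bl j))))
        where
        transposed-rowSum : ∀ t y → ∑< (rowPair (partner t)) (λ x → Z (partner t) x y) ≡ + κ t
        transposed-rowSum t y = trans (RegularMatrix.colSum (region (partner t)) y)
                                      (cong (λ u → + κ u) (partner-involutive t))

      A≢B : ¬ (A ≐ (A ⊕ E))
      A≢B A≐B = sign-nonzero (R.bl i) (C.bl j) (proj₂ (R.inPair π₁ hkl)) (proj₂ (C.inPair π₁ hab))
                  (identityʳ-unique (A i j) _ (sym (A≐B i j)))
        where
        i = proj₁ (R.inPair π₁ hkl)
        j = proj₁ (C.inPair π₁ hab)

    realize : Design → Realizable E
    realize D = A , A-binary , B-binary , A-binary , B-binary ,
                Rows.gram-sufficient A (Rows.forced A A-binary B-binary) Λ on-row ,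
                Cols.gram-sufficient (transpose A) (Cols.forced (transpose A) (λ j i → A-binary i j) (λ j i → B-binary i j))
                                     Λ' on-col ,
                A≢B
      where
      open Design D
      open Filling D

    design : ∀ u v → (∀ t → rowPair t ℕ.* u ≡ colPair (partner t) ℕ.* v) →
             (∀ t → u ℕ.≤ colPair t) → (∀ t → 2 ∣ u ℕ.+ colPair t) →
             (∀ t → v ℕ.≤ rowPair t) → (∀ t → 2 ∣ v ℕ.+ rowPair t) → Design
    design u v scale u≤ u-even v≤ v-even = record
      { Λ = + u ; Λ' = + v ; ρ = ρ ; κ = κ
      ; ρ-half = ρ-half ; κ-half = κ-half ; counts-agree = counts-agree
      ; ρ-bound = λ t → proj₂ (proj₂ (ρ-shift t)) }
      where
      slope± : ∀ t → pairSlope t ≡ pos ⊎ pairSlope t ≡ neg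
      slope± π₁ = inj₁ refl
      slope± π₂ = inj₂ refl
      slope± π₃ = inj₁ refl
      ρ-shift = λ t → half-shift (slope± t) u (C.size (first (partner t))) (C.size (second (partner t)))
                        (u≤ (partner t)) (u-even (partner t))
      κ-shift = λ t → half-shift (slope± t) v (R.size (first (partner t))) (R.size (second (partner t)))
                        (v≤ (partner t)) (v-even (partner t))
      ρ κ : Pair → ℕ
      ρ t = proj₁ (ρ-shift t)
      κ t = proj₁ (κ-shift t)
      ρ-half : ∀ t → + 2 * + ρ t ≡ pairSlope t * + u + pairSize n (partner t)
      ρ-half t = proj₁ (proj₂ (ρ-shift t))
      κ-half : ∀ t → + 2 * + κ t ≡ pairSlope t * + v + pairSize m (partner t)
      κ-half t = proj₁ (proj₂ (κ-shift t))
      counts-agree : ∀ t → rowPair t ℕ.* ρ t ≡ colPair (partner t) ℕ.* κ (partner t)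
      counts-agree t = ℤP.+-injective (trans (pos-pairSize-* R.size t (ρ t))
        (trans (halves-agree {pairSize m t} {pairSize n (partner t)} {+ u} {+ v} {pairSlope t} scale-ℤ (ρ-half t) κ-half′)
               (sym (pos-pairSize-* C.size (partner t) (κ (partner t))))))
        where
        scale-ℤ : pairSize m t * + u ≡ pairSize n (partner t) * + v
        scale-ℤ = trans (sym (pos-pairSize-* R.size t u))
                        (trans (cong +_ (scale t)) (pos-pairSize-* C.size (partner t) v))
        κ-half′ : + 2 * + κ (partner t) ≡ pairSlope t * + v + pairSize m t
        κ-half′ = trans (κ-half (partner t)) (cong₂ (λ σ t' → σ * + v + pairSize m t')
                                                    (pairSlope-partner t) (partner-involutive t))

    sufficient : Condition a b c d e f k l p q r s → Realizable E
    sufficient (inj₁ (2∣ab , 2∣cd , 2∣ef , 2∣kl , 2∣pq , 2∣rs)) =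
      realize (design 0 0 (λ t → trans (ℕP.*-zeroʳ (rowPair t)) (sym (ℕP.*-zeroʳ (colPair (partner t)))))
                      (λ _ → ℕ.z≤n) col-even (λ _ → ℕ.z≤n) row-even)
      where
      col-even : ∀ t → 2 ∣ colPair t
      col-even π₁ = 2∣ab
      col-even π₂ = 2∣cd
      col-even π₃ = 2∣ef
      row-even : ∀ t → 2 ∣ rowPair t
      row-even π₁ = 2∣kl
      row-even π₂ = 2∣pq
      row-even π₃ = 2∣rs
    sufficient (inj₂ (_ , ratio₁ , ratio₂)) = realize (design u v scale minimal u-even v≤ v-even)
      where
      s₀ = proj₁ (minimal-pair colPair)
      minimal = proj₂ (minimal-pair colPair)
      u = colPair s₀
      v = rowPair (partner s₀)
      scale : ∀ t → rowPair t ℕ.* u ≡ colPair (partner t) ℕ.* v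
      scale t = proportional-pairs rowPair colPair hpq ratio₁ ratio₂ t s₀
      u-even : ∀ t → 2 ∣ u ℕ.+ colPair t
      u-even = same-parity colPair (pairs-same-parity a b c d n-balance₂) (pairs-same-parity a b e f n-balance₃) s₀
      v≤ : ∀ t → v ℕ.≤ rowPair t
      v≤ t = factor-bound (scale t) (minimal (partner t)) (colPair-positive (partner t))
      v-even : ∀ t → 2 ∣ v ℕ.+ rowPair t
      v-even = same-parity rowPair (pairs-same-parity k l p q m-balance₂) (pairs-same-parity k l r s m-balance₃) (partner s₀)

open import Data.Nat using (ℕ; _+_; _*_; _>_)
open import Data.Nat.Divisibility using (_∣_)
open import Data.Product using (_×_)
open import Data.Sum using (_⊎_)
open import Function.Bundles using (_⇔_; mk⇔)
open import Relation.Binary.PropositionalEquality using (_≡_)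
open import Relation.Nullary using (¬_)

theorem4p35 : (a b c d e f k l p q r s : ℕ) →
    a + b > 0 → c + d > 0 → e + f > 0 → k + l > 0 → p + q > 0 → r + s > 0 →
    RowSumsZero (Emat a b c d e f k l p q r s) →
    ColSumsZero (Emat a b c d e f k l p q r s) →
    Realizable (Emat a b c d e f k l p q r s) ⇔
      ((2 ∣ (a + b) × 2 ∣ (c + d) × 2 ∣ (e + f) × 2 ∣ (k + l) × 2 ∣ (p + q) × 2 ∣ (r + s))
       ⊎ (((¬ 2 ∣ (a + b) × ¬ 2 ∣ (c + d) × ¬ 2 ∣ (e + f))
           ⊎ (¬ 2 ∣ (k + l) × ¬ 2 ∣ (p + q) × ¬ 2 ∣ (r + s)))
          × ((e + f) * (p + q) ≡ (c + d) * (k + l))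
          × ((c + d) * (r + s) ≡ (a + b) * (p + q))))
theorem4p35 a b c d e f k l p q r s hab hcd hef hkl hpq hrs rowSums colSums =
  mk⇔ (λ realizable → conditions (necessary realizable)) sufficient
  where open Instance a b c d e f k l p q r s hab hcd hef hkl hpq hrs rowSums colSums
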